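{- Let $\theta(x)$ be any boolean combination of atomic formulas of the form $D_n(2^sx)$, where $n\ge1$ and $s\ge0$ are integers and $x$ is a single variable (no other variables occur), and let $M$ be the least common multiple of the indices $n$ occurring in $\theta$. Then either $T\vdash\forall x\,\neg\theta(x)$, or $T\vdash\forall u\big(0<u\to\exists x\,(u\le x<2^Mu\wedge\theta(x))\big)$.
   Context: Let $L$ be the language with constant symbols $0,1$, binary function symbols $+,-,\times$, the binary relation $<$, a unary function symbol $\lambda$, a unary predicate $A$, and unary predicates $D_n$ for each integer $n\ge 1$. Let $T$ be the $L$-theory consisting of the axioms of real closed ordered fields together with: $\forall x(A(x)\to x>0)$; $\forall x,y(A(x)\to(A(y)\leftrightarrow A(xy)))$; $A(2)\wedge\forall x(1<x<2\to\neg A(x))$; $\forall x(x>0\to\exists y(A(y)\wedge y\le x<2y))$; for each $n\ge1$, $\forall x(D_n(x)\leftrightarrow\exists y(A(y)\wedge y^n=x))$; $\forall x(x\le 0\to\lambda(x)=0)$; $\forall x(x>0\to A(\lambda(x))\wedge\lambda(x)\le x<2\lambda(x))$. Here $2$ abbreviates $1+1$ and $2^s$ ($s\ge0$) the corresponding numeral. -}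

module Defs where

open import Data.Nat using (ℕ; zero; suc; _+_; NonZero)
open import Data.Nat.LCM using (lcm)
open import Data.Fin using (Fin; zero; suc)
open import Data.List using (List; []; _∷_; map; foldr; allFin; _++_)
open import Data.List.Membership.Propositional using (_∈_)

-- Syntax of the language L (terms/formulas with n free variables,
-- de Bruijn indices; var zero = innermost bound variable).

infixl 7 _⊗_
infixl 6 _⊕_ _⊖_
infix  4 _≐_ _<'_ _≤'_
infixr 3 _∧'_
infixr 2 _∨'_
infixr 1 _⇒_ _⇔_

data Term (n : ℕ) : Set where
  var : Fin n → Term n
  `0 `1 : Term n
  _⊕_ _⊖_ _⊗_ : Term n → Term n → Term n
  lam : Term n → Term n

data Formula (n : ℕ) : Set where
  ⊥' : Formula n
  _≐_ _<'_ : Term n → Term n → Formula n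
  A : Term n → Formula n
  D : (k : ℕ) → {{NonZero k}} → Term n → Formula n
  _⇒_ _∧'_ _∨'_ : Formula n → Formula n → Formula n
  ∀' ∃' : Formula (suc n) → Formula n

¬' : ∀ {n} → Formula n → Formula n
¬' φ = φ ⇒ ⊥'

_⇔_ : ∀ {n} → Formula n → Formula n → Formula n
φ ⇔ ψ = (φ ⇒ ψ) ∧' (ψ ⇒ φ)

_≤'_ : ∀ {n} → Term n → Term n → Formula n
s ≤' t = s <' t ∨' s ≐ t

two : ∀ {n} → Term n
two = `1 ⊕ `1

_^'_ : ∀ {n} → Term n → ℕ → Term n
t ^' zero = `1
t ^' suc zero = t
t ^' suc (suc k) = (t ^' suc k) ⊗ t

ext : ∀ {n m} → (Fin n → Fin m) → Fin (suc n) → Fin (suc m)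
ext ρ zero = zero
ext ρ (suc i) = suc (ρ i)

renT : ∀ {n m} → (Fin n → Fin m) → Term n → Term m
renT ρ (var i) = var (ρ i)
renT ρ `0 = `0
renT ρ `1 = `1
renT ρ (s ⊕ t) = renT ρ s ⊕ renT ρ t
renT ρ (s ⊖ t) = renT ρ s ⊖ renT ρ t
renT ρ (s ⊗ t) = renT ρ s ⊗ renT ρ t
renT ρ (lam t) = lam (renT ρ t)

renF : ∀ {n m} → (Fin n → Fin m) → Formula n → Formula m
renF ρ ⊥' = ⊥'
renF ρ (s ≐ t) = renT ρ s ≐ renT ρ t
renF ρ (s <' t) = renT ρ s <' renT ρ t
renF ρ (A t) = A (renT ρ t)
renF ρ (D k {{nz}} t) = D k {{nz}} (renT ρ t)
renF ρ (φ ⇒ ψ) = renF ρ φ ⇒ renF ρ ψ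
renF ρ (φ ∧' ψ) = renF ρ φ ∧' renF ρ ψ
renF ρ (φ ∨' ψ) = renF ρ φ ∨' renF ρ ψ
renF ρ (∀' φ) = ∀' (renF (ext ρ) φ)
renF ρ (∃' φ) = ∃' (renF (ext ρ) φ)

exts : ∀ {n m} → (Fin n → Term m) → Fin (suc n) → Term (suc m)
exts σ zero = var zero
exts σ (suc i) = renT suc (σ i)

subT : ∀ {n m} → (Fin n → Term m) → Term n → Term m
subT σ (var i) = σ i
subT σ `0 = `0
subT σ `1 = `1
subT σ (s ⊕ t) = subT σ s ⊕ subT σ t
subT σ (s ⊖ t) = subT σ s ⊖ subT σ t
subT σ (s ⊗ t) = subT σ s ⊗ subT σ t
subT σ (lam t) = lam (subT σ t)

subF : ∀ {n m} → (Fin n → Term m) → Formula n → Formula m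
subF σ ⊥' = ⊥'
subF σ (s ≐ t) = subT σ s ≐ subT σ t
subF σ (s <' t) = subT σ s <' subT σ t
subF σ (A t) = A (subT σ t)
subF σ (D k {{nz}} t) = D k {{nz}} (subT σ t)
subF σ (φ ⇒ ψ) = subF σ φ ⇒ subF σ ψ
subF σ (φ ∧' ψ) = subF σ φ ∧' subF σ ψ
subF σ (φ ∨' ψ) = subF σ φ ∨' subF σ ψ
subF σ (∀' φ) = ∀' (subF (exts σ) φ)
subF σ (∃' φ) = ∃' (subF (exts σ) φ)

single : ∀ {n} → Term n → Fin (suc n) → Term n
single t zero = t
single t (suc i) = var i

_[_] : ∀ {n} → Formula (suc n) → Term n → Formula n
φ [ t ] = subF (single t) φ

wk : ∀ {n} → Formula n → Formula (suc n)
wk = renF suc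

closeF : ∀ {n} → Formula 0 → Formula n
closeF = renF (λ ())

v0 : ∀ {n} → Term (suc n)
v0 = var zero
v1 : ∀ {n} → Term (suc (suc n))
v1 = var (suc zero)
v2 : ∀ {n} → Term (suc (suc (suc n)))
v2 = var (suc (suc zero))

-- Odd-degree axiom scheme of RCF:
-- ∀ a_0 … a_{d-1} ∃ x  x^d + a_{d-1} x^{d-1} + … + a_0 = 0,  d = 2k+1.

-- Horner: horner x [c_0,…,c_{d-1}] = x^d + c_{d-1}x^{d-1} + … + c_0
horner : ∀ {n} → Term n → List (Term n) → Term n
horner x [] = `1
horner x (c ∷ cs) = horner x cs ⊗ x ⊕ c

allsN : (m : ℕ) → Formula m → Formula 0
allsN zero φ = φ
allsN (suc m) φ = allsN m (∀' φ)

oddRoot : ℕ → Formula 0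
oddRoot k = allsN d (∃' (horner v0 (map (λ i → var (suc i)) (allFin d)) ≐ `0))
  where d = suc (k + k)

data T : Formula 0 → Set where
  +-assoc  : T (∀' (∀' (∀' ((v2 ⊕ v1) ⊕ v0 ≐ v2 ⊕ (v1 ⊕ v0)))))
  +-comm   : T (∀' (∀' (v1 ⊕ v0 ≐ v0 ⊕ v1)))
  +-zero   : T (∀' (v0 ⊕ `0 ≐ v0))
  minus    : T (∀' (∀' ((v1 ⊖ v0) ⊕ v0 ≐ v1)))
  *-assoc  : T (∀' (∀' (∀' ((v2 ⊗ v1) ⊗ v0 ≐ v2 ⊗ (v1 ⊗ v0)))))
  *-comm   : T (∀' (∀' (v1 ⊗ v0 ≐ v0 ⊗ v1)))
  *-one    : T (∀' (v0 ⊗ `1 ≐ v0))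
  distrib  : T (∀' (∀' (∀' (v2 ⊗ (v1 ⊕ v0) ≐ v2 ⊗ v1 ⊕ v2 ⊗ v0))))
  zero≠one : T (¬' (`0 ≐ `1))
  inverse  : T (∀' (¬' (v0 ≐ `0) ⇒ ∃' (v1 ⊗ v0 ≐ `1)))
  <-irrefl : T (∀' (¬' (v0 <' v0)))
  <-trans  : T (∀' (∀' (∀' (v2 <' v1 ⇒ v1 <' v0 ⇒ v2 <' v0))))
  <-trich  : T (∀' (∀' (v1 <' v0 ∨' v1 ≐ v0 ∨' v0 <' v1)))
  <-+      : T (∀' (∀' (∀' (v2 <' v1 ⇒ v2 ⊕ v0 <' v1 ⊕ v0))))
  <-*      : T (∀' (∀' (`0 <' v1 ⇒ `0 <' v0 ⇒ `0 <' v1 ⊗ v0)))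
  sqrt     : T (∀' (`0 <' v0 ⇒ ∃' (v0 ⊗ v0 ≐ v1)))
  odd-root : (k : ℕ) → T (oddRoot k)
  A-pos    : T (∀' (A v0 ⇒ `0 <' v0))
  A-mul    : T (∀' (∀' (A v1 ⇒ (A v0 ⇔ A (v1 ⊗ v0)))))
  A-two    : T (A two ∧' ∀' (`1 <' v0 ∧' v0 <' two ⇒ ¬' (A v0)))
  A-bound  : T (∀' (`0 <' v0 ⇒ ∃' (A v0 ∧' v0 ≤' v1 ∧' v1 <' two ⊗ v0)))
  D-def    : (k : ℕ) → {{_ : NonZero k}} →
             T (∀' (D k v0 ⇔ ∃' (A v0 ∧' (v0 ^' k) ≐ v1)))
  lam-nonpos : T (∀' (v0 ≤' `0 ⇒ lam v0 ≐ `0))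
  lam-pos    : T (∀' (`0 <' v0 ⇒ A (lam v0) ∧' lam v0 ≤' v0 ∧' v0 <' two ⊗ lam v0))

infix 0 _⊢_

data _⊢_ : {n : ℕ} → List (Formula n) → Formula n → Set where
  hyp  : ∀ {n} {Γ : List (Formula n)} {φ} → φ ∈ Γ → Γ ⊢ φ
  ax   : ∀ {n} {Γ : List (Formula n)} {σ} → T σ → Γ ⊢ closeF σ
  raa  : ∀ {n} {Γ : List (Formula n)} {φ} → (¬' φ ∷ Γ) ⊢ ⊥' → Γ ⊢ φ
  ⇒I   : ∀ {n} {Γ : List (Formula n)} {φ ψ} → (φ ∷ Γ) ⊢ ψ → Γ ⊢ φ ⇒ ψ
  ⇒E   : ∀ {n} {Γ : List (Formula n)} {φ ψ} → Γ ⊢ φ ⇒ ψ → Γ ⊢ φ → Γ ⊢ ψ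
  ∧I   : ∀ {n} {Γ : List (Formula n)} {φ ψ} → Γ ⊢ φ → Γ ⊢ ψ → Γ ⊢ φ ∧' ψ
  ∧E₁  : ∀ {n} {Γ : List (Formula n)} {φ ψ} → Γ ⊢ φ ∧' ψ → Γ ⊢ φ
  ∧E₂  : ∀ {n} {Γ : List (Formula n)} {φ ψ} → Γ ⊢ φ ∧' ψ → Γ ⊢ ψ
  ∨I₁  : ∀ {n} {Γ : List (Formula n)} {φ ψ} → Γ ⊢ φ → Γ ⊢ φ ∨' ψ
  ∨I₂  : ∀ {n} {Γ : List (Formula n)} {φ ψ} → Γ ⊢ ψ → Γ ⊢ φ ∨' ψ
  ∨E   : ∀ {n} {Γ : List (Formula n)} {φ ψ χ} →
         Γ ⊢ φ ∨' ψ → (φ ∷ Γ) ⊢ χ → (ψ ∷ Γ) ⊢ χ → Γ ⊢ χ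
  ∀I   : ∀ {n} {Γ : List (Formula n)} {φ} → map wk Γ ⊢ φ → Γ ⊢ ∀' φ
  ∀E   : ∀ {n} {Γ : List (Formula n)} {φ} → Γ ⊢ ∀' φ → (t : Term n) → Γ ⊢ φ [ t ]
  ∃I   : ∀ {n} {Γ : List (Formula n)} {φ} → (t : Term n) → Γ ⊢ φ [ t ] → Γ ⊢ ∃' φ
  ∃E   : ∀ {n} {Γ : List (Formula n)} {φ ψ} →
         Γ ⊢ ∃' φ → (φ ∷ map wk Γ) ⊢ wk ψ → Γ ⊢ ψ
  ≐-refl  : ∀ {n} {Γ : List (Formula n)} {t} → Γ ⊢ t ≐ t
  ≐-subst : ∀ {n} {Γ : List (Formula n)} (φ : Formula (suc n)) {t u} →
            Γ ⊢ t ≐ u → Γ ⊢ φ [ t ] → Γ ⊢ φ [ u ]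

Provable : Formula 0 → Set
Provable σ = [] ⊢ σ

data BComb : Set where
  atom : (n : ℕ) → {{NonZero n}} → (s : ℕ) → BComb   -- D_n(2^s x)
  notB : BComb → BComb
  andB orB : BComb → BComb → BComb

⟦_⟧ : ∀ {m} → BComb → Term m → Formula m
⟦ atom n {{nz}} s ⟧ t = D n {{nz}} ((two ^' s) ⊗ t)
⟦ notB θ ⟧ t = ¬' (⟦ θ ⟧ t)
⟦ andB θ ψ ⟧ t = ⟦ θ ⟧ t ∧' ⟦ ψ ⟧ t
⟦ orB θ ψ ⟧ t = ⟦ θ ⟧ t ∨' ⟦ ψ ⟧ t

indices : BComb → List ℕ
indices (atom n s) = n ∷ []
indices (notB θ) = indices θ
indices (andB θ ψ) = indices θ ++ indices ψ
indices (orB θ ψ) = indices θ ++ indices ψ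

lcmIdx : BComb → ℕ
lcmIdx θ = foldr lcm 1 (indices θ)

module Submission where

-- A model of T sees A as a multiplicative group containing 2 with A ∩ (1,2) = ∅. Taking an
-- M-th root w of x ∈ A and b = λ(w), so that b^M ≤ x < 2^M b^M, shows that A is the union of
-- the cosets 2^r A^M, r < M. For n ∣ M the atom D_n(2^s x) holds on 2^t A^M exactly when
-- n ∣ s + t, and it fails off A. Hence θ(x) only depends on whether x ∉ A or on the residue of
-- t mod M. If θ fails in all these M + 1 cases, T ⊢ ∀x ¬θ(x). Otherwise, for u > 0 the interval
-- [u, 2^M u) contains a point outside A (3u/2 or u) and, since λ(u) ≤ u < 2λ(u), points
-- 2^j λ(u) of every residue. This works for any positive common multiple M of the indices.

open import Defs
open import Data.Bool using (Bool; true; false; not; _∧_; _∨_)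
import Data.Bool.Properties as Bool
open import Data.Fin using (Fin; zero; suc)
open import Data.List using (List; []; _∷_; map; foldr; tabulate; allFin)
open import Data.List.Properties using (map-tabulate; map-∘; map-cong)
open import Data.List.Membership.Propositional.Properties using (∈-map⁺)
open import Data.List.Relation.Binary.Subset.Propositional using (_⊆_)
open import Data.List.Relation.Binary.Subset.Propositional.Properties using (xs⊆x∷xs; ∷⁺ʳ; map⁺)
open import Data.List.Relation.Unary.All using (All; []; _∷_)
import Data.List.Relation.Unary.All as All
open import Data.List.Relation.Unary.All.Properties using (++⁺; ++⁻ˡ; ++⁻ʳ)
open import Data.List.Relation.Unary.Any using (here; there)
open import Data.Nat using (ℕ; zero; suc; NonZero; _+_; _*_; _∸_; _/_; _%_)
open import Data.Nat.DivMod using (m≡m%n+[m/n]*n; m%n<n)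
open import Data.Nat.Divisibility using (_∣_; _∣?_; ∣-trans; divides; m%n≡0⇒n∣m; ∣m+n∣m⇒∣n; ∣m∣n⇒∣m+n)
import Data.Nat as ℕ
import Data.Nat.Properties as ℕ
open import Data.Nat.Induction using (<-rec)
open import Data.Nat.GCD using (gcd)
open import Data.Nat.LCM using (lcm; gcd*lcm; m∣lcm[m,n]; n∣lcm[m,n])
open import Data.Product using (Σ; _,_; _×_)
open import Data.Sum using (_⊎_; inj₁; inj₂)
open import Function using (_∘_)
open import Function.Bundles using (mk⇔)
open import Relation.Nullary using (¬_; does; yes; no)
open import Relation.Nullary.Negation using (contradiction)
open import Relation.Nullary.Decidable using (does-⇔)
open import Relation.Binary.PropositionalEquality
  using (_≡_; _≗_; refl; sym; trans; cong; cong₂; subst; subst₂)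

variable
  n m k : ℕ
  Γ : List (Formula n)
  φ ψ χ ξ : Formula n
  a b c s t u : Term n

ext-cong : {ρ ρ' : Fin n → Fin m} → ρ ≗ ρ' → ext ρ ≗ ext ρ'
ext-cong h zero = refl
ext-cong h (suc i) = cong suc (h i)

renT-cong : {ρ ρ' : Fin n → Fin m} → ρ ≗ ρ' → renT ρ ≗ renT ρ'
renT-cong h (var i) = cong var (h i)
renT-cong h `0 = refl
renT-cong h `1 = refl
renT-cong h (s ⊕ t) = cong₂ _⊕_ (renT-cong h s) (renT-cong h t)
renT-cong h (s ⊖ t) = cong₂ _⊖_ (renT-cong h s) (renT-cong h t)
renT-cong h (s ⊗ t) = cong₂ _⊗_ (renT-cong h s) (renT-cong h t)
renT-cong h (lam t) = cong lam (renT-cong h t)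

renF-cong : {ρ ρ' : Fin n → Fin m} → ρ ≗ ρ' → renF ρ ≗ renF ρ'
renF-cong h ⊥' = refl
renF-cong h (s ≐ t) = cong₂ _≐_ (renT-cong h s) (renT-cong h t)
renF-cong h (s <' t) = cong₂ _<'_ (renT-cong h s) (renT-cong h t)
renF-cong h (A t) = cong A (renT-cong h t)
renF-cong h (D k t) = cong (D k) (renT-cong h t)
renF-cong h (φ ⇒ ψ) = cong₂ _⇒_ (renF-cong h φ) (renF-cong h ψ)
renF-cong h (φ ∧' ψ) = cong₂ _∧'_ (renF-cong h φ) (renF-cong h ψ)
renF-cong h (φ ∨' ψ) = cong₂ _∨'_ (renF-cong h φ) (renF-cong h ψ)
renF-cong h (∀' φ) = cong ∀' (renF-cong (ext-cong h) φ)
renF-cong h (∃' φ) = cong ∃' (renF-cong (ext-cong h) φ)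

ext-∘ : (ρ : Fin m → Fin k) (ρ' : Fin n → Fin m) → ext ρ ∘ ext ρ' ≗ ext (ρ ∘ ρ')
ext-∘ ρ ρ' zero = refl
ext-∘ ρ ρ' (suc i) = refl

renT-∘ : (ρ : Fin m → Fin k) (ρ' : Fin n → Fin m) → renT ρ ∘ renT ρ' ≗ renT (ρ ∘ ρ')
renT-∘ ρ ρ' (var i) = refl
renT-∘ ρ ρ' `0 = refl
renT-∘ ρ ρ' `1 = refl
renT-∘ ρ ρ' (s ⊕ t) = cong₂ _⊕_ (renT-∘ ρ ρ' s) (renT-∘ ρ ρ' t)
renT-∘ ρ ρ' (s ⊖ t) = cong₂ _⊖_ (renT-∘ ρ ρ' s) (renT-∘ ρ ρ' t)
renT-∘ ρ ρ' (s ⊗ t) = cong₂ _⊗_ (renT-∘ ρ ρ' s) (renT-∘ ρ ρ' t)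
renT-∘ ρ ρ' (lam t) = cong lam (renT-∘ ρ ρ' t)

renF-∘ : (ρ : Fin m → Fin k) (ρ' : Fin n → Fin m) → renF ρ ∘ renF ρ' ≗ renF (ρ ∘ ρ')
renF-∘ ρ ρ' ⊥' = refl
renF-∘ ρ ρ' (s ≐ t) = cong₂ _≐_ (renT-∘ ρ ρ' s) (renT-∘ ρ ρ' t)
renF-∘ ρ ρ' (s <' t) = cong₂ _<'_ (renT-∘ ρ ρ' s) (renT-∘ ρ ρ' t)
renF-∘ ρ ρ' (A t) = cong A (renT-∘ ρ ρ' t)
renF-∘ ρ ρ' (D k t) = cong (D k) (renT-∘ ρ ρ' t)
renF-∘ ρ ρ' (φ ⇒ ψ) = cong₂ _⇒_ (renF-∘ ρ ρ' φ) (renF-∘ ρ ρ' ψ)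
renF-∘ ρ ρ' (φ ∧' ψ) = cong₂ _∧'_ (renF-∘ ρ ρ' φ) (renF-∘ ρ ρ' ψ)
renF-∘ ρ ρ' (φ ∨' ψ) = cong₂ _∨'_ (renF-∘ ρ ρ' φ) (renF-∘ ρ ρ' ψ)
renF-∘ ρ ρ' (∀' φ) = cong ∀' (trans (renF-∘ (ext ρ) (ext ρ') φ) (renF-cong (ext-∘ ρ ρ') φ))
renF-∘ ρ ρ' (∃' φ) = cong ∃' (trans (renF-∘ (ext ρ) (ext ρ') φ) (renF-cong (ext-∘ ρ ρ') φ))

exts-cong : {σ σ' : Fin n → Term m} → σ ≗ σ' → exts σ ≗ exts σ'
exts-cong h zero = refl
exts-cong h (suc i) = cong (renT suc) (h i)

subT-cong : {σ σ' : Fin n → Term m} → σ ≗ σ' → subT σ ≗ subT σ'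
subT-cong h (var i) = h i
subT-cong h `0 = refl
subT-cong h `1 = refl
subT-cong h (s ⊕ t) = cong₂ _⊕_ (subT-cong h s) (subT-cong h t)
subT-cong h (s ⊖ t) = cong₂ _⊖_ (subT-cong h s) (subT-cong h t)
subT-cong h (s ⊗ t) = cong₂ _⊗_ (subT-cong h s) (subT-cong h t)
subT-cong h (lam t) = cong lam (subT-cong h t)

subF-cong : {σ σ' : Fin n → Term m} → σ ≗ σ' → subF σ ≗ subF σ'
subF-cong h ⊥' = refl
subF-cong h (s ≐ t) = cong₂ _≐_ (subT-cong h s) (subT-cong h t)
subF-cong h (s <' t) = cong₂ _<'_ (subT-cong h s) (subT-cong h t)
subF-cong h (A t) = cong A (subT-cong h t)
subF-cong h (D k t) = cong (D k) (subT-cong h t)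
subF-cong h (φ ⇒ ψ) = cong₂ _⇒_ (subF-cong h φ) (subF-cong h ψ)
subF-cong h (φ ∧' ψ) = cong₂ _∧'_ (subF-cong h φ) (subF-cong h ψ)
subF-cong h (φ ∨' ψ) = cong₂ _∨'_ (subF-cong h φ) (subF-cong h ψ)
subF-cong h (∀' φ) = cong ∀' (subF-cong (exts-cong h) φ)
subF-cong h (∃' φ) = cong ∃' (subF-cong (exts-cong h) φ)

exts-ext : (σ : Fin m → Term k) (ρ : Fin n → Fin m) → exts σ ∘ ext ρ ≗ exts (σ ∘ ρ)
exts-ext σ ρ zero = refl
exts-ext σ ρ (suc i) = refl

subT-renT : (σ : Fin m → Term k) (ρ : Fin n → Fin m) → subT σ ∘ renT ρ ≗ subT (σ ∘ ρ)
subT-renT σ ρ (var i) = refl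
subT-renT σ ρ `0 = refl
subT-renT σ ρ `1 = refl
subT-renT σ ρ (s ⊕ t) = cong₂ _⊕_ (subT-renT σ ρ s) (subT-renT σ ρ t)
subT-renT σ ρ (s ⊖ t) = cong₂ _⊖_ (subT-renT σ ρ s) (subT-renT σ ρ t)
subT-renT σ ρ (s ⊗ t) = cong₂ _⊗_ (subT-renT σ ρ s) (subT-renT σ ρ t)
subT-renT σ ρ (lam t) = cong lam (subT-renT σ ρ t)

subF-renF : (σ : Fin m → Term k) (ρ : Fin n → Fin m) → subF σ ∘ renF ρ ≗ subF (σ ∘ ρ)
subF-renF σ ρ ⊥' = refl
subF-renF σ ρ (s ≐ t) = cong₂ _≐_ (subT-renT σ ρ s) (subT-renT σ ρ t)
subF-renF σ ρ (s <' t) = cong₂ _<'_ (subT-renT σ ρ s) (subT-renT σ ρ t)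
subF-renF σ ρ (A t) = cong A (subT-renT σ ρ t)
subF-renF σ ρ (D k t) = cong (D k) (subT-renT σ ρ t)
subF-renF σ ρ (φ ⇒ ψ) = cong₂ _⇒_ (subF-renF σ ρ φ) (subF-renF σ ρ ψ)
subF-renF σ ρ (φ ∧' ψ) = cong₂ _∧'_ (subF-renF σ ρ φ) (subF-renF σ ρ ψ)
subF-renF σ ρ (φ ∨' ψ) = cong₂ _∨'_ (subF-renF σ ρ φ) (subF-renF σ ρ ψ)
subF-renF σ ρ (∀' φ) = cong ∀' (trans (subF-renF (exts σ) (ext ρ) φ) (subF-cong (exts-ext σ ρ) φ))
subF-renF σ ρ (∃' φ) = cong ∃' (trans (subF-renF (exts σ) (ext ρ) φ) (subF-cong (exts-ext σ ρ) φ))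

renT-subT : (ρ : Fin m → Fin k) (σ : Fin n → Term m) → renT ρ ∘ subT σ ≗ subT (renT ρ ∘ σ)
renT-subT ρ σ (var i) = refl
renT-subT ρ σ `0 = refl
renT-subT ρ σ `1 = refl
renT-subT ρ σ (s ⊕ t) = cong₂ _⊕_ (renT-subT ρ σ s) (renT-subT ρ σ t)
renT-subT ρ σ (s ⊖ t) = cong₂ _⊖_ (renT-subT ρ σ s) (renT-subT ρ σ t)
renT-subT ρ σ (s ⊗ t) = cong₂ _⊗_ (renT-subT ρ σ s) (renT-subT ρ σ t)
renT-subT ρ σ (lam t) = cong lam (renT-subT ρ σ t)

ext-exts : (ρ : Fin m → Fin k) (σ : Fin n → Term m) → renT (ext ρ) ∘ exts σ ≗ exts (renT ρ ∘ σ)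
ext-exts ρ σ zero = refl
ext-exts ρ σ (suc i) = trans (renT-∘ (ext ρ) suc (σ i)) (sym (renT-∘ suc ρ (σ i)))

renF-subF : (ρ : Fin m → Fin k) (σ : Fin n → Term m) → renF ρ ∘ subF σ ≗ subF (renT ρ ∘ σ)
renF-subF ρ σ ⊥' = refl
renF-subF ρ σ (s ≐ t) = cong₂ _≐_ (renT-subT ρ σ s) (renT-subT ρ σ t)
renF-subF ρ σ (s <' t) = cong₂ _<'_ (renT-subT ρ σ s) (renT-subT ρ σ t)
renF-subF ρ σ (A t) = cong A (renT-subT ρ σ t)
renF-subF ρ σ (D k t) = cong (D k) (renT-subT ρ σ t)
renF-subF ρ σ (φ ⇒ ψ) = cong₂ _⇒_ (renF-subF ρ σ φ) (renF-subF ρ σ ψ)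
renF-subF ρ σ (φ ∧' ψ) = cong₂ _∧'_ (renF-subF ρ σ φ) (renF-subF ρ σ ψ)
renF-subF ρ σ (φ ∨' ψ) = cong₂ _∨'_ (renF-subF ρ σ φ) (renF-subF ρ σ ψ)
renF-subF ρ σ (∀' φ) = cong ∀' (trans (renF-subF (ext ρ) (exts σ) φ) (subF-cong (ext-exts ρ σ) φ))
renF-subF ρ σ (∃' φ) = cong ∃' (trans (renF-subF (ext ρ) (exts σ) φ) (subF-cong (ext-exts ρ σ) φ))

exts-∘ : (σ₂ : Fin m → Term k) (σ₁ : Fin n → Term m) → subT (exts σ₂) ∘ exts σ₁ ≗ exts (subT σ₂ ∘ σ₁)
exts-∘ σ₂ σ₁ zero = refl
exts-∘ σ₂ σ₁ (suc i) = trans (subT-renT (exts σ₂) suc (σ₁ i)) (sym (renT-subT suc σ₂ (σ₁ i)))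

subT-∘ : (σ₂ : Fin m → Term k) (σ₁ : Fin n → Term m) → subT σ₂ ∘ subT σ₁ ≗ subT (subT σ₂ ∘ σ₁)
subT-∘ σ₂ σ₁ (var i) = refl
subT-∘ σ₂ σ₁ `0 = refl
subT-∘ σ₂ σ₁ `1 = refl
subT-∘ σ₂ σ₁ (s ⊕ t) = cong₂ _⊕_ (subT-∘ σ₂ σ₁ s) (subT-∘ σ₂ σ₁ t)
subT-∘ σ₂ σ₁ (s ⊖ t) = cong₂ _⊖_ (subT-∘ σ₂ σ₁ s) (subT-∘ σ₂ σ₁ t)
subT-∘ σ₂ σ₁ (s ⊗ t) = cong₂ _⊗_ (subT-∘ σ₂ σ₁ s) (subT-∘ σ₂ σ₁ t)
subT-∘ σ₂ σ₁ (lam t) = cong lam (subT-∘ σ₂ σ₁ t)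

subF-∘ : (σ₂ : Fin m → Term k) (σ₁ : Fin n → Term m) → subF σ₂ ∘ subF σ₁ ≗ subF (subT σ₂ ∘ σ₁)
subF-∘ σ₂ σ₁ ⊥' = refl
subF-∘ σ₂ σ₁ (s ≐ t) = cong₂ _≐_ (subT-∘ σ₂ σ₁ s) (subT-∘ σ₂ σ₁ t)
subF-∘ σ₂ σ₁ (s <' t) = cong₂ _<'_ (subT-∘ σ₂ σ₁ s) (subT-∘ σ₂ σ₁ t)
subF-∘ σ₂ σ₁ (A t) = cong A (subT-∘ σ₂ σ₁ t)
subF-∘ σ₂ σ₁ (D k t) = cong (D k) (subT-∘ σ₂ σ₁ t)
subF-∘ σ₂ σ₁ (φ ⇒ ψ) = cong₂ _⇒_ (subF-∘ σ₂ σ₁ φ) (subF-∘ σ₂ σ₁ ψ)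
subF-∘ σ₂ σ₁ (φ ∧' ψ) = cong₂ _∧'_ (subF-∘ σ₂ σ₁ φ) (subF-∘ σ₂ σ₁ ψ)
subF-∘ σ₂ σ₁ (φ ∨' ψ) = cong₂ _∨'_ (subF-∘ σ₂ σ₁ φ) (subF-∘ σ₂ σ₁ ψ)
subF-∘ σ₂ σ₁ (∀' φ) = cong ∀' (trans (subF-∘ (exts σ₂) (exts σ₁) φ) (subF-cong (exts-∘ σ₂ σ₁) φ))
subF-∘ σ₂ σ₁ (∃' φ) = cong ∃' (trans (subF-∘ (exts σ₂) (exts σ₁) φ) (subF-cong (exts-∘ σ₂ σ₁) φ))

subT-var : (t : Term n) → subT var t ≡ t
subT-var (var i) = refl
subT-var `0 = refl
subT-var `1 = refl
subT-var (s ⊕ t) = cong₂ _⊕_ (subT-var s) (subT-var t)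
subT-var (s ⊖ t) = cong₂ _⊖_ (subT-var s) (subT-var t)
subT-var (s ⊗ t) = cong₂ _⊗_ (subT-var s) (subT-var t)
subT-var (lam t) = cong lam (subT-var t)

subT-var∘ : (ρ : Fin n → Fin m) → subT (var ∘ ρ) ≗ renT ρ
subT-var∘ ρ (var i) = refl
subT-var∘ ρ `0 = refl
subT-var∘ ρ `1 = refl
subT-var∘ ρ (s ⊕ t) = cong₂ _⊕_ (subT-var∘ ρ s) (subT-var∘ ρ t)
subT-var∘ ρ (s ⊖ t) = cong₂ _⊖_ (subT-var∘ ρ s) (subT-var∘ ρ t)
subT-var∘ ρ (s ⊗ t) = cong₂ _⊗_ (subT-var∘ ρ s) (subT-var∘ ρ t)
subT-var∘ ρ (lam t) = cong lam (subT-var∘ ρ t)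

exts-var∘ : (ρ : Fin n → Fin m) → exts (var ∘ ρ) ≗ var ∘ ext ρ
exts-var∘ ρ zero = refl
exts-var∘ ρ (suc i) = refl

subF-var∘ : (ρ : Fin n → Fin m) → subF (var ∘ ρ) ≗ renF ρ
subF-var∘ ρ ⊥' = refl
subF-var∘ ρ (s ≐ t) = cong₂ _≐_ (subT-var∘ ρ s) (subT-var∘ ρ t)
subF-var∘ ρ (s <' t) = cong₂ _<'_ (subT-var∘ ρ s) (subT-var∘ ρ t)
subF-var∘ ρ (A t) = cong A (subT-var∘ ρ t)
subF-var∘ ρ (D k t) = cong (D k) (subT-var∘ ρ t)
subF-var∘ ρ (φ ⇒ ψ) = cong₂ _⇒_ (subF-var∘ ρ φ) (subF-var∘ ρ ψ)
subF-var∘ ρ (φ ∧' ψ) = cong₂ _∧'_ (subF-var∘ ρ φ) (subF-var∘ ρ ψ)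
subF-var∘ ρ (φ ∨' ψ) = cong₂ _∨'_ (subF-var∘ ρ φ) (subF-var∘ ρ ψ)
subF-var∘ ρ (∀' φ) = cong ∀' (trans (subF-cong (exts-var∘ ρ) φ) (subF-var∘ (ext ρ) φ))
subF-var∘ ρ (∃' φ) = cong ∃' (trans (subF-cong (exts-var∘ ρ) φ) (subF-var∘ (ext ρ) φ))

single-wk : (u t : Term n) → subT (single u) (renT suc t) ≡ t
single-wk u t = trans (subT-renT (single u) suc t) (subT-var t)

wk-ext : (ρ : Fin n → Fin m) (t : Term n) → renT (ext ρ) (renT suc t) ≡ renT suc (renT ρ t)
wk-ext ρ t = trans (renT-∘ (ext ρ) suc t) (sym (renT-∘ suc ρ t))

renF-wk : (ρ : Fin n → Fin m) (φ : Formula n) → renF (ext ρ) (wk φ) ≡ wk (renF ρ φ)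
renF-wk ρ φ = trans (renF-∘ (ext ρ) suc φ) (sym (renF-∘ suc ρ φ))

renF-[] : (ρ : Fin n → Fin m) (t : Term n) (φ : Formula (suc n)) →
          renF ρ (φ [ t ]) ≡ renF (ext ρ) φ [ renT ρ t ]
renF-[] ρ t φ = trans (renF-subF ρ (single t) φ)
  (trans (subF-cong single-ext φ) (sym (subF-renF (single (renT ρ t)) (ext ρ) φ)))
  where
  single-ext : renT ρ ∘ single t ≗ single (renT ρ t) ∘ ext ρ
  single-ext zero = refl
  single-ext (suc i) = refl

renF-closeF : (ρ : Fin n → Fin m) (σ : Formula 0) → renF ρ (closeF σ) ≡ closeF σ
renF-closeF ρ σ = trans (renF-∘ ρ (λ ()) σ) (renF-cong (λ ()) σ)

renT-^' : (ρ : Fin n → Fin m) (t : Term n) (k : ℕ) → renT ρ (t ^' k) ≡ renT ρ t ^' k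
renT-^' ρ t zero = refl
renT-^' ρ t (suc zero) = refl
renT-^' ρ t (suc (suc k)) = cong (_⊗ renT ρ t) (renT-^' ρ t (suc k))

subT-^' : (σ : Fin n → Term m) (t : Term n) (k : ℕ) → subT σ (t ^' k) ≡ subT σ t ^' k
subT-^' σ t zero = refl
subT-^' σ t (suc zero) = refl
subT-^' σ t (suc (suc k)) = cong (_⊗ subT σ t) (subT-^' σ t (suc k))

hyp₀ : (φ ∷ Γ) ⊢ φ
hyp₀ = hyp (here refl)

map-renF-wk : (ρ : Fin n → Fin m) (Γ : List (Formula n)) →
              map (renF (ext ρ)) (map wk Γ) ≡ map wk (map (renF ρ) Γ)
map-renF-wk ρ Γ = trans (sym (map-∘ Γ)) (trans (map-cong (renF-wk ρ) Γ) (map-∘ Γ))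

⊢-rename : (ρ : Fin n → Fin m) → Γ ⊢ φ → map (renF ρ) Γ ⊢ renF ρ φ
⊢-rename ρ (hyp φ∈Γ) = hyp (∈-map⁺ (renF ρ) φ∈Γ)
⊢-rename ρ (ax {σ = σ} α) = subst (_ ⊢_) (sym (renF-closeF ρ σ)) (ax α)
⊢-rename ρ (raa d) = raa (⊢-rename ρ d)
⊢-rename ρ (⇒I d) = ⇒I (⊢-rename ρ d)
⊢-rename ρ (⇒E d e) = ⇒E (⊢-rename ρ d) (⊢-rename ρ e)
⊢-rename ρ (∧I d e) = ∧I (⊢-rename ρ d) (⊢-rename ρ e)
⊢-rename ρ (∧E₁ d) = ∧E₁ (⊢-rename ρ d)
⊢-rename ρ (∧E₂ d) = ∧E₂ (⊢-rename ρ d)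
⊢-rename ρ (∨I₁ d) = ∨I₁ (⊢-rename ρ d)
⊢-rename ρ (∨I₂ d) = ∨I₂ (⊢-rename ρ d)
⊢-rename ρ (∨E d e f) = ∨E (⊢-rename ρ d) (⊢-rename ρ e) (⊢-rename ρ f)
⊢-rename {Γ = Γ} ρ (∀I {φ = φ} d) =
  ∀I (subst (_⊢ renF (ext ρ) φ) (map-renF-wk ρ Γ) (⊢-rename (ext ρ) d))
⊢-rename ρ (∀E {φ = φ} d t) =
  subst (_ ⊢_) (sym (renF-[] ρ t φ)) (∀E (⊢-rename ρ d) (renT ρ t))
⊢-rename ρ (∃I {φ = φ} t d) =
  ∃I (renT ρ t) (subst (_ ⊢_) (renF-[] ρ t φ) (⊢-rename ρ d))
⊢-rename {Γ = Γ} ρ (∃E {φ = φ} {ψ = ψ} d e) = ∃E (⊢-rename ρ d)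
  (subst₂ (λ Δ χ → (renF (ext ρ) φ ∷ Δ) ⊢ χ) (map-renF-wk ρ Γ) (renF-wk ρ ψ) (⊢-rename (ext ρ) e))
⊢-rename ρ ≐-refl = ≐-refl
⊢-rename ρ (≐-subst φ {t} {u} e d) = subst (_ ⊢_) (sym (renF-[] ρ u φ))
  (≐-subst (renF (ext ρ) φ) (⊢-rename ρ e) (subst (_ ⊢_) (renF-[] ρ t φ) (⊢-rename ρ d)))

weaken : {Δ : List (Formula n)} → Γ ⊆ Δ → Γ ⊢ φ → Δ ⊢ φ
weaken Γ⊆Δ (hyp φ∈Γ) = hyp (Γ⊆Δ φ∈Γ)
weaken Γ⊆Δ (ax α) = ax α
weaken Γ⊆Δ (raa d) = raa (weaken (∷⁺ʳ _ Γ⊆Δ) d)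
weaken Γ⊆Δ (⇒I d) = ⇒I (weaken (∷⁺ʳ _ Γ⊆Δ) d)
weaken Γ⊆Δ (⇒E d e) = ⇒E (weaken Γ⊆Δ d) (weaken Γ⊆Δ e)
weaken Γ⊆Δ (∧I d e) = ∧I (weaken Γ⊆Δ d) (weaken Γ⊆Δ e)
weaken Γ⊆Δ (∧E₁ d) = ∧E₁ (weaken Γ⊆Δ d)
weaken Γ⊆Δ (∧E₂ d) = ∧E₂ (weaken Γ⊆Δ d)
weaken Γ⊆Δ (∨I₁ d) = ∨I₁ (weaken Γ⊆Δ d)
weaken Γ⊆Δ (∨I₂ d) = ∨I₂ (weaken Γ⊆Δ d)
weaken Γ⊆Δ (∨E d e f) = ∨E (weaken Γ⊆Δ d) (weaken (∷⁺ʳ _ Γ⊆Δ) e) (weaken (∷⁺ʳ _ Γ⊆Δ) f)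
weaken Γ⊆Δ (∀I d) = ∀I (weaken (map⁺ wk Γ⊆Δ) d)
weaken Γ⊆Δ (∀E d t) = ∀E (weaken Γ⊆Δ d) t
weaken Γ⊆Δ (∃I t d) = ∃I t (weaken Γ⊆Δ d)
weaken Γ⊆Δ (∃E d e) = ∃E (weaken Γ⊆Δ d) (weaken (∷⁺ʳ _ (map⁺ wk Γ⊆Δ)) e)
weaken Γ⊆Δ ≐-refl = ≐-refl
weaken Γ⊆Δ (≐-subst φ e d) = ≐-subst φ (weaken Γ⊆Δ e) (weaken Γ⊆Δ d)

weaken₁ : Γ ⊢ φ → (ψ ∷ Γ) ⊢ φ
weaken₁ = weaken (xs⊆x∷xs _ _)

weaken-under : (ψ ∷ Γ) ⊢ χ → (ψ ∷ φ ∷ Γ) ⊢ χ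
weaken-under = weaken (∷⁺ʳ _ (xs⊆x∷xs _ _))

⊢-wk : Γ ⊢ φ → (ψ ∷ map wk Γ) ⊢ wk φ
⊢-wk d = weaken₁ (⊢-rename suc d)

cut : Γ ⊢ φ → (φ ∷ Γ) ⊢ ψ → Γ ⊢ ψ
cut d e = ⇒E (⇒I e) d

⊥E : Γ ⊢ ⊥' → Γ ⊢ φ
⊥E d = raa (weaken₁ d)

contradict : Γ ⊢ φ → Γ ⊢ ¬' φ → Γ ⊢ ψ
contradict d e = ⊥E (⇒E e d)

excluded-middle : Γ ⊢ φ ∨' ¬' φ
excluded-middle = raa (⇒E hyp₀ (∨I₂ (⇒I (⇒E (hyp (there (here refl))) (∨I₁ hyp₀)))))

by-cases : (φ ∷ Γ) ⊢ ψ → (¬' φ ∷ Γ) ⊢ ψ → Γ ⊢ ψ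
by-cases = ∨E excluded-middle

⇔E₁ : Γ ⊢ φ ⇔ ψ → Γ ⊢ φ → Γ ⊢ ψ
⇔E₁ d = ⇒E (∧E₁ d)

⇔E₂ : Γ ⊢ φ ⇔ ψ → Γ ⊢ ψ → Γ ⊢ φ
⇔E₂ d = ⇒E (∧E₂ d)

∨E₃ : Γ ⊢ φ ∨' ψ ∨' χ → (φ ∷ Γ) ⊢ ξ → (ψ ∷ Γ) ⊢ ξ → (χ ∷ Γ) ⊢ ξ → Γ ⊢ ξ
∨E₃ d e f g = ∨E d e (∨E hyp₀ (weaken-under f) (weaken-under g))

≐-cong : (C : Term (suc n)) → Γ ⊢ t ≐ u → Γ ⊢ subT (single t) C ≐ subT (single u) C
≐-cong {t = t} {u = u} C e =
  subst (λ r → _ ⊢ r ≐ subT (single u) C) (single-wk u (subT (single t) C))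
    (≐-subst (renT suc (subT (single t) C) ≐ C) e
      (subst (λ r → _ ⊢ r ≐ subT (single t) C) (sym (single-wk t (subT (single t) C))) ≐-refl))

≐-sym : Γ ⊢ s ≐ t → Γ ⊢ t ≐ s
≐-sym {s = s} {t = t} e = subst (λ r → _ ⊢ t ≐ r) (single-wk t s)
  (≐-subst (v0 ≐ renT suc s) e (subst (λ r → _ ⊢ s ≐ r) (sym (single-wk s s)) ≐-refl))

≐-trans : Γ ⊢ s ≐ t → Γ ⊢ t ≐ u → Γ ⊢ s ≐ u
≐-trans {s = s} {t = t} {u = u} e f = subst (λ r → _ ⊢ r ≐ u) (single-wk u s)
  (≐-subst (renT suc s ≐ v0) f (subst (λ r → _ ⊢ r ≐ t) (sym (single-wk t s)) e))

infixr 2 _≐⟨_⟩_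
infix 3 _∎

_≐⟨_⟩_ : (s : Term n) → Γ ⊢ s ≐ t → Γ ⊢ t ≐ u → Γ ⊢ s ≐ u
s ≐⟨ e ⟩ f = ≐-trans e f

_∎ : (s : Term n) → Γ ⊢ s ≐ s
s ∎ = ≐-refl

A-resp-≐ : Γ ⊢ s ≐ t → Γ ⊢ A s → Γ ⊢ A t
A-resp-≐ = ≐-subst (A v0)

D-resp-≐ : ∀ k {{_ : NonZero k}} → Γ ⊢ s ≐ t → Γ ⊢ D k s → Γ ⊢ D k t
D-resp-≐ k = ≐-subst (D k v0)

<'-respˡ-≐ : Γ ⊢ s ≐ t → Γ ⊢ s <' u → Γ ⊢ t <' u
<'-respˡ-≐ {s = s} {t = t} {u = u} e d = subst (λ r → _ ⊢ t <' r) (single-wk t u)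
  (≐-subst (v0 <' renT suc u) e (subst (λ r → _ ⊢ s <' r) (sym (single-wk s u)) d))

<'-respʳ-≐ : Γ ⊢ s ≐ t → Γ ⊢ u <' s → Γ ⊢ u <' t
<'-respʳ-≐ {s = s} {t = t} {u = u} e d = subst (λ r → _ ⊢ r <' t) (single-wk t u)
  (≐-subst (renT suc u <' v0) e (subst (λ r → _ ⊢ r <' s) (sym (single-wk s u)) d))

⊕-congˡ : Γ ⊢ s ≐ t → Γ ⊢ u ⊕ s ≐ u ⊕ t
⊕-congˡ {s = s} {t = t} {u = u} e =
  subst₂ (λ r r' → _ ⊢ r ⊕ s ≐ r' ⊕ t) (single-wk s u) (single-wk t u) (≐-cong (renT suc u ⊕ v0) e)

⊕-congʳ : Γ ⊢ s ≐ t → Γ ⊢ s ⊕ u ≐ t ⊕ u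
⊕-congʳ {s = s} {t = t} {u = u} e =
  subst₂ (λ r r' → _ ⊢ s ⊕ r ≐ t ⊕ r') (single-wk s u) (single-wk t u) (≐-cong (v0 ⊕ renT suc u) e)

⊗-congˡ : Γ ⊢ s ≐ t → Γ ⊢ u ⊗ s ≐ u ⊗ t
⊗-congˡ {s = s} {t = t} {u = u} e =
  subst₂ (λ r r' → _ ⊢ r ⊗ s ≐ r' ⊗ t) (single-wk s u) (single-wk t u) (≐-cong (renT suc u ⊗ v0) e)

⊗-congʳ : Γ ⊢ s ≐ t → Γ ⊢ s ⊗ u ≐ t ⊗ u
⊗-congʳ {s = s} {t = t} {u = u} e =
  subst₂ (λ r r' → _ ⊢ s ⊗ r ≐ t ⊗ r') (single-wk s u) (single-wk t u) (≐-cong (v0 ⊗ renT suc u) e)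

⊖-congˡ : Γ ⊢ s ≐ t → Γ ⊢ u ⊖ s ≐ u ⊖ t
⊖-congˡ {s = s} {t = t} {u = u} e =
  subst₂ (λ r r' → _ ⊢ r ⊖ s ≐ r' ⊖ t) (single-wk s u) (single-wk t u) (≐-cong (renT suc u ⊖ v0) e)

⊕-cong : Γ ⊢ s ≐ t → Γ ⊢ a ≐ b → Γ ⊢ s ⊕ a ≐ t ⊕ b
⊕-cong e f = ≐-trans (⊕-congʳ e) (⊕-congˡ f)

⊗-cong : Γ ⊢ s ≐ t → Γ ⊢ a ≐ b → Γ ⊢ s ⊗ a ≐ t ⊗ b
⊗-cong e f = ≐-trans (⊗-congʳ e) (⊗-congˡ f)

-- Ordered field arithmetic

single-wk² : (a b c : Term n) → subT (single c) (subT (exts (single b)) (renT suc (renT suc a))) ≡ a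
single-wk² a b c = trans
  (cong (subT (single c)) (trans (subT-renT (exts (single b)) suc (renT suc a))
    (trans (subT-renT _ suc a) (subT-var∘ suc a))))
  (single-wk c a)

⊕-assoc : ∀ a b c → Γ ⊢ (a ⊕ b) ⊕ c ≐ a ⊕ (b ⊕ c)
⊕-assoc a b c = subst₂ (λ x y → _ ⊢ (x ⊕ y) ⊕ c ≐ x ⊕ (y ⊕ c))
  (single-wk² a b c) (single-wk c b) (∀E (∀E (∀E (ax +-assoc) a) b) c)

⊕-comm : ∀ a b → Γ ⊢ a ⊕ b ≐ b ⊕ a
⊕-comm a b = subst (λ x → _ ⊢ x ⊕ b ≐ b ⊕ x) (single-wk b a) (∀E (∀E (ax +-comm) a) b)

⊕-identityʳ : ∀ a → Γ ⊢ a ⊕ `0 ≐ a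
⊕-identityʳ a = ∀E (ax +-zero) a

⊖-⊕ : ∀ a b → Γ ⊢ (a ⊖ b) ⊕ b ≐ a
⊖-⊕ a b = subst (λ x → _ ⊢ (x ⊖ b) ⊕ b ≐ x) (single-wk b a) (∀E (∀E (ax minus) a) b)

⊗-assoc : ∀ a b c → Γ ⊢ (a ⊗ b) ⊗ c ≐ a ⊗ (b ⊗ c)
⊗-assoc a b c = subst₂ (λ x y → _ ⊢ (x ⊗ y) ⊗ c ≐ x ⊗ (y ⊗ c))
  (single-wk² a b c) (single-wk c b) (∀E (∀E (∀E (ax *-assoc) a) b) c)

⊗-comm : ∀ a b → Γ ⊢ a ⊗ b ≐ b ⊗ a
⊗-comm a b = subst (λ x → _ ⊢ x ⊗ b ≐ b ⊗ x) (single-wk b a) (∀E (∀E (ax *-comm) a) b)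

⊗-identityʳ : ∀ a → Γ ⊢ a ⊗ `1 ≐ a
⊗-identityʳ a = ∀E (ax *-one) a

⊗-distribˡ-⊕ : ∀ a b c → Γ ⊢ a ⊗ (b ⊕ c) ≐ a ⊗ b ⊕ a ⊗ c
⊗-distribˡ-⊕ a b c = subst₂ (λ x y → _ ⊢ x ⊗ (y ⊕ c) ≐ x ⊗ y ⊕ x ⊗ c)
  (single-wk² a b c) (single-wk c b) (∀E (∀E (∀E (ax distrib) a) b) c)

<'-irrefl : ∀ a → Γ ⊢ ¬' (a <' a)
<'-irrefl a = ∀E (ax <-irrefl) a

<'-trans : Γ ⊢ a <' b → Γ ⊢ b <' c → Γ ⊢ a <' c
<'-trans {a = a} {b = b} {c = c} = ⇒E ∘ ⇒E (subst₂ (λ x y → _ ⊢ x <' y ⇒ y <' c ⇒ x <' c)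
  (single-wk² a b c) (single-wk c b) (∀E (∀E (∀E (ax <-trans) a) b) c))

<'-cmp : ∀ a b → Γ ⊢ a <' b ∨' a ≐ b ∨' b <' a
<'-cmp a b = subst (λ x → _ ⊢ x <' b ∨' x ≐ b ∨' b <' x) (single-wk b a) (∀E (∀E (ax <-trich) a) b)

⊕-monoˡ-<' : ∀ c → Γ ⊢ a <' b → Γ ⊢ a ⊕ c <' b ⊕ c
⊕-monoˡ-<' {a = a} {b = b} c = ⇒E (subst₂ (λ x y → _ ⊢ x <' y ⇒ x ⊕ c <' y ⊕ c)
  (single-wk² a b c) (single-wk c b) (∀E (∀E (∀E (ax <-+) a) b) c))

⊗-pos : Γ ⊢ `0 <' a → Γ ⊢ `0 <' b → Γ ⊢ `0 <' a ⊗ b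
⊗-pos {a = a} {b = b} = ⇒E ∘ ⇒E (subst (λ x → _ ⊢ `0 <' x ⇒ `0 <' b ⇒ `0 <' x ⊗ b)
  (single-wk b a) (∀E (∀E (ax <-*) a) b))

neg : Term n → Term n
neg a = `0 ⊖ a

⊕-identityˡ : ∀ a → Γ ⊢ `0 ⊕ a ≐ a
⊕-identityˡ a = ≐-trans (⊕-comm `0 a) (⊕-identityʳ a)

⊗-identityˡ : ∀ a → Γ ⊢ `1 ⊗ a ≐ a
⊗-identityˡ a = ≐-trans (⊗-comm `1 a) (⊗-identityʳ a)

⊕-inverseˡ : ∀ a → Γ ⊢ neg a ⊕ a ≐ `0
⊕-inverseˡ a = ⊖-⊕ `0 a

⊕-inverseʳ : ∀ a → Γ ⊢ a ⊕ neg a ≐ `0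
⊕-inverseʳ a = ≐-trans (⊕-comm a (neg a)) (⊕-inverseˡ a)

⊕-neg-cancelʳ : ∀ a b → Γ ⊢ (a ⊕ neg b) ⊕ b ≐ a
⊕-neg-cancelʳ a b =
  (a ⊕ neg b) ⊕ b ≐⟨ ⊕-assoc a (neg b) b ⟩
  a ⊕ (neg b ⊕ b) ≐⟨ ⊕-congˡ (⊕-inverseˡ b) ⟩
  a ⊕ `0          ≐⟨ ⊕-identityʳ a ⟩
  a               ∎

⊕-cancelʳ : ∀ a b c → Γ ⊢ a ⊕ c ≐ b ⊕ c → Γ ⊢ a ≐ b
⊕-cancelʳ a b c e =
  a               ≐⟨ ≐-sym (⊕-neg-cancelʳ a c) ⟩
  (a ⊕ neg c) ⊕ c ≐⟨ ⊕-assoc a (neg c) c ⟩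
  a ⊕ (neg c ⊕ c) ≐⟨ ⊕-congˡ (⊕-comm (neg c) c) ⟩
  a ⊕ (c ⊕ neg c) ≐⟨ ≐-sym (⊕-assoc a c (neg c)) ⟩
  (a ⊕ c) ⊕ neg c ≐⟨ ⊕-congʳ e ⟩
  (b ⊕ c) ⊕ neg c ≐⟨ ⊕-assoc b c (neg c) ⟩
  b ⊕ (c ⊕ neg c) ≐⟨ ⊕-congˡ (⊕-inverseʳ c) ⟩
  b ⊕ `0          ≐⟨ ⊕-identityʳ b ⟩
  b               ∎

⊗-zeroʳ : ∀ a → Γ ⊢ a ⊗ `0 ≐ `0
⊗-zeroʳ a = ⊕-cancelʳ (a ⊗ `0) `0 (a ⊗ `0)
  (a ⊗ `0 ⊕ a ⊗ `0 ≐⟨ ≐-sym (⊗-distribˡ-⊕ a `0 `0) ⟩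
   a ⊗ (`0 ⊕ `0)   ≐⟨ ⊗-congˡ (⊕-identityʳ `0) ⟩
   a ⊗ `0          ≐⟨ ≐-sym (⊕-identityˡ (a ⊗ `0)) ⟩
   `0 ⊕ a ⊗ `0     ∎)

⊗-distribʳ-⊕ : ∀ a b c → Γ ⊢ (b ⊕ c) ⊗ a ≐ b ⊗ a ⊕ c ⊗ a
⊗-distribʳ-⊕ a b c =
  (b ⊕ c) ⊗ a     ≐⟨ ⊗-comm (b ⊕ c) a ⟩
  a ⊗ (b ⊕ c)     ≐⟨ ⊗-distribˡ-⊕ a b c ⟩
  a ⊗ b ⊕ a ⊗ c   ≐⟨ ⊕-cong (⊗-comm a b) (⊗-comm a c) ⟩
  b ⊗ a ⊕ c ⊗ a   ∎

⊗-negʳ : ∀ a b → Γ ⊢ a ⊗ neg b ≐ neg (a ⊗ b)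
⊗-negʳ a b = ⊕-cancelʳ (a ⊗ neg b) (neg (a ⊗ b)) (a ⊗ b)
  (a ⊗ neg b ⊕ a ⊗ b   ≐⟨ ≐-sym (⊗-distribˡ-⊕ a (neg b) b) ⟩
   a ⊗ (neg b ⊕ b)     ≐⟨ ⊗-congˡ (⊕-inverseˡ b) ⟩
   a ⊗ `0              ≐⟨ ⊗-zeroʳ a ⟩
   `0                  ≐⟨ ≐-sym (⊕-inverseˡ (a ⊗ b)) ⟩
   neg (a ⊗ b) ⊕ a ⊗ b ∎)

neg-involutive : ∀ a → Γ ⊢ neg (neg a) ≐ a
neg-involutive a = ⊕-cancelʳ (neg (neg a)) a (neg a)
  (≐-trans (⊕-inverseˡ (neg a)) (≐-sym (⊕-inverseʳ a)))

neg⊗neg : ∀ a b → Γ ⊢ neg a ⊗ neg b ≐ a ⊗ b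
neg⊗neg a b =
  neg a ⊗ neg b     ≐⟨ ⊗-negʳ (neg a) b ⟩
  neg (neg a ⊗ b)   ≐⟨ ⊖-congˡ (⊗-comm (neg a) b) ⟩
  neg (b ⊗ neg a)   ≐⟨ ⊖-congˡ (⊗-negʳ b a) ⟩
  neg (neg (b ⊗ a)) ≐⟨ neg-involutive (b ⊗ a) ⟩
  b ⊗ a             ≐⟨ ⊗-comm b a ⟩
  a ⊗ b             ∎

x⊗yz≐y⊗xz : ∀ a b c → Γ ⊢ a ⊗ (b ⊗ c) ≐ b ⊗ (a ⊗ c)
x⊗yz≐y⊗xz a b c =
  a ⊗ (b ⊗ c) ≐⟨ ≐-sym (⊗-assoc a b c) ⟩
  (a ⊗ b) ⊗ c ≐⟨ ⊗-congʳ (⊗-comm a b) ⟩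
  (b ⊗ a) ⊗ c ≐⟨ ⊗-assoc b a c ⟩
  b ⊗ (a ⊗ c) ∎

xy⊗zw≐xz⊗yw : ∀ a b c d → Γ ⊢ (a ⊗ b) ⊗ (c ⊗ d) ≐ (a ⊗ c) ⊗ (b ⊗ d)
xy⊗zw≐xz⊗yw a b c d =
  (a ⊗ b) ⊗ (c ⊗ d) ≐⟨ ⊗-assoc a b (c ⊗ d) ⟩
  a ⊗ (b ⊗ (c ⊗ d)) ≐⟨ ⊗-congˡ (x⊗yz≐y⊗xz b c d) ⟩
  a ⊗ (c ⊗ (b ⊗ d)) ≐⟨ ≐-sym (⊗-assoc a c (b ⊗ d)) ⟩
  (a ⊗ c) ⊗ (b ⊗ d) ∎

<'-asym : Γ ⊢ a <' b → Γ ⊢ b <' a → Γ ⊢ φ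
<'-asym {a = a} d e = contradict (<'-trans d e) (<'-irrefl a)

pos⇒≢0 : Γ ⊢ `0 <' a → Γ ⊢ ¬' (a ≐ `0)
pos⇒≢0 d = ⇒I (⇒E (<'-irrefl `0) (<'-respʳ-≐ hyp₀ (weaken₁ d)))

≤'-refl : Γ ⊢ a ≤' a
≤'-refl = ∨I₂ ≐-refl

≤'-<'-trans : Γ ⊢ a ≤' b → Γ ⊢ b <' c → Γ ⊢ a <' c
≤'-<'-trans d e = ∨E d (<'-trans hyp₀ (weaken₁ e)) (<'-respˡ-≐ (≐-sym hyp₀) (weaken₁ e))

<'-≤'-trans : Γ ⊢ a <' b → Γ ⊢ b ≤' c → Γ ⊢ a <' c
<'-≤'-trans d e = ∨E e (<'-trans (weaken₁ d) hyp₀) (<'-respʳ-≐ hyp₀ (weaken₁ d))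

≤'-respˡ-≐ : Γ ⊢ s ≐ t → Γ ⊢ s ≤' u → Γ ⊢ t ≤' u
≤'-respˡ-≐ e d = ∨E d (∨I₁ (<'-respˡ-≐ (weaken₁ e) hyp₀)) (∨I₂ (≐-trans (≐-sym (weaken₁ e)) hyp₀))

≤'-respʳ-≐ : Γ ⊢ s ≐ t → Γ ⊢ u ≤' s → Γ ⊢ u ≤' t
≤'-respʳ-≐ e d = ∨E d (∨I₁ (<'-respʳ-≐ (weaken₁ e) hyp₀)) (∨I₂ (≐-trans hyp₀ (weaken₁ e)))

≮'⇒≥' : Γ ⊢ ¬' (a <' b) → Γ ⊢ b ≤' a
≮'⇒≥' {a = a} {b = b} d =
  ∨E₃ (<'-cmp a b) (contradict hyp₀ (weaken₁ d)) (∨I₂ (≐-sym hyp₀)) (∨I₁ hyp₀)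

neg-pos : Γ ⊢ a <' `0 → Γ ⊢ `0 <' neg a
neg-pos {a = a} d =
  <'-respʳ-≐ (⊕-identityˡ (neg a)) (<'-respˡ-≐ (⊕-inverseʳ a) (⊕-monoˡ-<' (neg a) d))

-- If 1 < 0 then 0 < -1, hence 0 < (-1)(-1) = 1.
0<'1 : Γ ⊢ `0 <' `1
0<'1 = ∨E₃ (<'-cmp `0 `1) hyp₀ (contradict hyp₀ (ax zero≠one))
  (<'-asym hyp₀ (<'-respʳ-≐ (≐-trans (neg⊗neg `1 `1) (⊗-identityʳ `1)) (⊗-pos (neg-pos hyp₀) (neg-pos hyp₀))))

⊗-monoʳ-<' : Γ ⊢ `0 <' c → Γ ⊢ a <' b → Γ ⊢ c ⊗ a <' c ⊗ b
⊗-monoʳ-<' {c = c} {a = a} {b = b} c>0 a<b =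
  <'-respʳ-≐ (≐-trans (≐-sym (⊗-distribˡ-⊕ c (b ⊕ neg a) a)) (⊗-congˡ (⊕-neg-cancelʳ b a)))
    (<'-respˡ-≐ (⊕-identityˡ (c ⊗ a)) (⊕-monoˡ-<' (c ⊗ a) (⊗-pos c>0 b-a>0)))
  where
  b-a>0 = <'-respˡ-≐ (⊕-inverseʳ a) (⊕-monoˡ-<' (neg a) a<b)

⊗-monoˡ-<' : Γ ⊢ `0 <' c → Γ ⊢ a <' b → Γ ⊢ a ⊗ c <' b ⊗ c
⊗-monoˡ-<' {c = c} {a = a} {b = b} c>0 a<b =
  <'-respˡ-≐ (⊗-comm c a) (<'-respʳ-≐ (⊗-comm c b) (⊗-monoʳ-<' c>0 a<b))

⊗-monoʳ-≤' : Γ ⊢ `0 <' c → Γ ⊢ a ≤' b → Γ ⊢ c ⊗ a ≤' c ⊗ b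
⊗-monoʳ-≤' c>0 a≤b = ∨E a≤b (∨I₁ (⊗-monoʳ-<' (weaken₁ c>0) hyp₀)) (∨I₂ (⊗-congˡ hyp₀))

⊗-monoˡ-≤' : Γ ⊢ `0 <' c → Γ ⊢ a ≤' b → Γ ⊢ a ⊗ c ≤' b ⊗ c
⊗-monoˡ-≤' c>0 a≤b = ∨E a≤b (∨I₁ (⊗-monoˡ-<' (weaken₁ c>0) hyp₀)) (∨I₂ (⊗-congʳ hyp₀))

⊗-cancelˡ-<' : Γ ⊢ `0 <' c → Γ ⊢ c ⊗ a <' c ⊗ b → Γ ⊢ a <' b
⊗-cancelˡ-<' {a = a} {b = b} c>0 ca<cb = ∨E₃ (<'-cmp a b) hyp₀
  (contradict (<'-respˡ-≐ (⊗-congˡ hyp₀) (weaken₁ ca<cb)) (<'-irrefl _))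
  (<'-asym (weaken₁ ca<cb) (⊗-monoʳ-<' (weaken₁ c>0) hyp₀))

⊗-cancelˡ-≤' : Γ ⊢ `0 <' c → Γ ⊢ c ⊗ a ≤' c ⊗ b → Γ ⊢ a ≤' b
⊗-cancelˡ-≤' {a = a} {b = b} c>0 ca≤cb = ∨E₃ (<'-cmp a b) (∨I₁ hyp₀) (∨I₂ hyp₀)
  (contradict (≤'-<'-trans (weaken₁ ca≤cb) (⊗-monoʳ-<' (weaken₁ c>0) hyp₀)) (<'-irrefl _))

⊗-negʳ-<' : Γ ⊢ `0 <' a → Γ ⊢ b <' `0 → Γ ⊢ a ⊗ b <' `0
⊗-negʳ-<' {a = a} a>0 b<0 = <'-respʳ-≐ (⊗-zeroʳ a) (⊗-monoʳ-<' a>0 b<0)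

1<'2 : Γ ⊢ `1 <' two
1<'2 = <'-respˡ-≐ (⊕-identityˡ `1) (⊕-monoˡ-<' `1 0<'1)

0<'2 : Γ ⊢ `0 <' two
0<'2 = <'-trans 0<'1 1<'2

^'-suc : ∀ (t : Term n) k → Γ ⊢ t ^' suc k ≐ (t ^' k) ⊗ t
^'-suc t zero = ≐-sym (⊗-identityˡ t)
^'-suc t (suc k) = ≐-refl

^'-pos : ∀ k → Γ ⊢ `0 <' t → Γ ⊢ `0 <' t ^' k
^'-pos zero t>0 = 0<'1
^'-pos {t = t} (suc k) t>0 = <'-respʳ-≐ (≐-sym (^'-suc t k)) (⊗-pos (^'-pos k t>0) t>0)

^'-+ : ∀ (t : Term n) i j → Γ ⊢ (t ^' i) ⊗ (t ^' j) ≐ t ^' (i + j)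
^'-+ t zero j = ⊗-identityˡ (t ^' j)
^'-+ t (suc i) j =
  (t ^' suc i) ⊗ (t ^' j)   ≐⟨ ⊗-congʳ (^'-suc t i) ⟩
  ((t ^' i) ⊗ t) ⊗ (t ^' j) ≐⟨ ⊗-assoc (t ^' i) t (t ^' j) ⟩
  (t ^' i) ⊗ (t ⊗ (t ^' j)) ≐⟨ ⊗-congˡ (⊗-comm t (t ^' j)) ⟩
  (t ^' i) ⊗ ((t ^' j) ⊗ t) ≐⟨ ≐-sym (⊗-assoc (t ^' i) (t ^' j) t) ⟩
  ((t ^' i) ⊗ (t ^' j)) ⊗ t ≐⟨ ⊗-congʳ (^'-+ t i j) ⟩
  (t ^' (i + j)) ⊗ t        ≐⟨ ≐-sym (^'-suc t (i + j)) ⟩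
  t ^' suc (i + j)          ∎

^'-distrib-⊗ : ∀ (s t : Term n) k → Γ ⊢ (s ⊗ t) ^' k ≐ (s ^' k) ⊗ (t ^' k)
^'-distrib-⊗ s t zero = ≐-sym (⊗-identityʳ `1)
^'-distrib-⊗ s t (suc k) =
  (s ⊗ t) ^' suc k                ≐⟨ ^'-suc (s ⊗ t) k ⟩
  ((s ⊗ t) ^' k) ⊗ (s ⊗ t)        ≐⟨ ⊗-congʳ (^'-distrib-⊗ s t k) ⟩
  ((s ^' k) ⊗ (t ^' k)) ⊗ (s ⊗ t) ≐⟨ xy⊗zw≐xz⊗yw (s ^' k) (t ^' k) s t ⟩
  ((s ^' k) ⊗ s) ⊗ ((t ^' k) ⊗ t) ≐⟨ ≐-sym (⊗-cong (^'-suc s k) (^'-suc t k)) ⟩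
  (s ^' suc k) ⊗ (t ^' suc k)     ∎

^'-* : ∀ (t : Term n) i j → Γ ⊢ (t ^' i) ^' j ≐ t ^' (i * j)
^'-* {Γ = Γ} t i zero = subst (λ x → Γ ⊢ `1 ≐ t ^' x) (sym (ℕ.*-zeroʳ i)) ≐-refl
^'-* {Γ = Γ} t i (suc j) = subst (λ x → Γ ⊢ (t ^' i) ^' suc j ≐ t ^' x) (sym (ℕ.*-suc i j))
  ((t ^' i) ^' suc j          ≐⟨ ^'-suc (t ^' i) j ⟩
   ((t ^' i) ^' j) ⊗ (t ^' i) ≐⟨ ⊗-congʳ (^'-* t i j) ⟩
   (t ^' (i * j)) ⊗ (t ^' i)  ≐⟨ ⊗-comm _ _ ⟩
   (t ^' i) ⊗ (t ^' (i * j))  ≐⟨ ^'-+ t i (i * j) ⟩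
   t ^' (i + i * j)           ∎)

^'-cong : ∀ k → Γ ⊢ s ≐ t → Γ ⊢ s ^' k ≐ t ^' k
^'-cong zero e = ≐-refl
^'-cong {s = s} {t = t} (suc k) e =
  ≐-trans (^'-suc s k) (≐-trans (⊗-cong (^'-cong k e) e) (≐-sym (^'-suc t k)))

^'-mono-<' : ∀ k → Γ ⊢ `0 <' s → Γ ⊢ s <' t → Γ ⊢ s ^' suc k <' t ^' suc k
^'-mono-<' zero s>0 s<t = s<t
^'-mono-<' (suc k) s>0 s<t = <'-trans (⊗-monoʳ-<' (^'-pos (suc k) s>0) s<t)
  (⊗-monoˡ-<' (<'-trans s>0 s<t) (^'-mono-<' k s>0 s<t))

^'-mono-≤' : ∀ k → Γ ⊢ `0 <' s → Γ ⊢ s ≤' t → Γ ⊢ s ^' k ≤' t ^' k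
^'-mono-≤' zero s>0 s≤t = ≤'-refl
^'-mono-≤' (suc k) s>0 s≤t =
  ∨E s≤t (∨I₁ (^'-mono-<' k (weaken₁ s>0) hyp₀)) (∨I₂ (^'-cong (suc k) hyp₀))

0^'suc : ∀ k → Γ ⊢ `0 ^' suc k ≐ `0
0^'suc k = ≐-trans (^'-suc `0 k) (⊗-zeroʳ _)

2^_ : ℕ → Term n
2^ k = two ^' k

2^-pos : ∀ k → Γ ⊢ `0 <' 2^ k
2^-pos k = ^'-pos k 0<'2

2^-<'-suc : ∀ k → Γ ⊢ 2^ k <' 2^ suc k
2^-<'-suc k = <'-respˡ-≐ (⊗-identityʳ (2^ k)) (<'-respʳ-≐ (≐-sym (^'-suc two k)) (⊗-monoʳ-<' (2^-pos k) 1<'2))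

2^-mono-<' : ∀ {i} j → i ℕ.< j → Γ ⊢ 2^ i <' 2^ j
2^-mono-<' (suc j) i<1+j with ℕ.m<1+n⇒m<n∨m≡n i<1+j
... | inj₁ i<j = <'-trans (2^-mono-<' j i<j) (2^-<'-suc j)
... | inj₂ refl = 2^-<'-suc j

2^-mono-≤' : ∀ {i} j → i ℕ.≤ j → Γ ⊢ 2^ i ≤' 2^ j
2^-mono-≤' j i≤j with ℕ.m≤n⇒m<n∨m≡n i≤j
... | inj₁ i<j = ∨I₁ (2^-mono-<' j i<j)
... | inj₂ refl = ≤'-refl

1≤'2^ : ∀ k → Γ ⊢ `1 ≤' 2^ k
1≤'2^ k = 2^-mono-≤' k ℕ.z≤n

1<'2^suc : ∀ k → Γ ⊢ `1 <' 2^ suc k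
1<'2^suc k = 2^-mono-<' (suc k) (ℕ.s≤s ℕ.z≤n)

renT-2^ : (ρ : Fin n → Fin m) (k : ℕ) → renT ρ (2^ k) ≡ 2^ k
renT-2^ ρ = renT-^' ρ two

subT-2^ : (σ : Fin n → Term m) (k : ℕ) → subT σ (2^ k) ≡ 2^ k
subT-2^ σ = subT-^' σ two

-- The subgroup A and the function λ

A⇒pos : Γ ⊢ A a → Γ ⊢ `0 <' a
A⇒pos {a = a} = ⇒E (∀E (ax A-pos) a)

A-⊗⇔ : ∀ a b → Γ ⊢ A a ⇒ (A b ⇔ A (a ⊗ b))
A-⊗⇔ a b = subst (λ x → _ ⊢ A x ⇒ (A b ⇔ A (x ⊗ b))) (single-wk b a) (∀E (∀E (ax A-mul) a) b)

A-⊗ : Γ ⊢ A a → Γ ⊢ A b → Γ ⊢ A (a ⊗ b)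
A-⊗ {a = a} {b = b} Aa = ⇔E₁ (⇒E (A-⊗⇔ a b) Aa)

A-cancelˡ : Γ ⊢ A a → Γ ⊢ A (a ⊗ b) → Γ ⊢ A b
A-cancelˡ {a = a} {b = b} Aa = ⇔E₂ (⇒E (A-⊗⇔ a b) Aa)

A-2 : Γ ⊢ A two
A-2 = ∧E₁ (ax A-two)

A-gap : Γ ⊢ `1 <' a → Γ ⊢ a <' two → Γ ⊢ A a → Γ ⊢ φ
A-gap {a = a} 1<a a<2 Aa = contradict Aa (⇒E (∀E (∧E₂ (ax A-two)) a) (∧I 1<a a<2))

A-1 : Γ ⊢ A `1
A-1 = A-cancelˡ A-2 (A-resp-≐ (≐-sym (⊗-identityʳ two)) A-2)

A-^' : ∀ k → Γ ⊢ A a → Γ ⊢ A (a ^' k)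
A-^' zero Aa = A-1
A-^' {a = a} (suc k) Aa = A-resp-≐ (≐-sym (^'-suc a k)) (A-⊗ (A-^' k Aa) Aa)

A-2^ : ∀ k → Γ ⊢ A (2^ k)
A-2^ k = A-^' k A-2

λ-spec : Γ ⊢ `0 <' u → Γ ⊢ A (lam u) ∧' lam u ≤' u ∧' u <' two ⊗ lam u
λ-spec {u = u} = ⇒E (∀E (ax lam-pos) u)

quotient : ∀ b → Γ ⊢ `0 <' a → Γ ⊢ ∃' (renT suc a ⊗ v0 ≐ renT suc b)
quotient {a = a} b a>0 = ∃E (⇒E (∀E (ax inverse) a) (pos⇒≢0 a>0))
  (∃I (renT suc b ⊗ v0)
    (subst₂ (λ x y → _ ⊢ x ⊗ (renT suc b ⊗ v0) ≐ y) (sym (single-wk-ext a)) (sym (single-wk-ext b))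
      (≐-trans (x⊗yz≐y⊗xz (renT suc a) (renT suc b) v0) (≐-trans (⊗-congˡ hyp₀) (⊗-identityʳ _)))))
  where
  single-wk-ext : ∀ {w} (t : Term _) → subT (single w) (renT (ext suc) (renT suc t)) ≡ renT suc t
  single-wk-ext {w} t = trans (cong (subT (single w)) (wk-ext suc t)) (single-wk w (renT suc t))

A-discrete₁ : Γ ⊢ A a → Γ ⊢ `1 ≤' a → Γ ⊢ a <' two → Γ ⊢ a ≐ `1
A-discrete₁ Aa 1≤a a<2 = ∨E 1≤a (A-gap hyp₀ (weaken₁ a<2) (weaken₁ Aa)) (≐-sym hyp₀)

A-discrete : ∀ r → Γ ⊢ A a → Γ ⊢ 2^ r ≤' a → Γ ⊢ a <' 2^ suc r → Γ ⊢ a ≐ 2^ r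
A-discrete {Γ = Γ} {a = a} r Aa lo hi = ∃E (quotient a (2^-pos r))
  (subst (Δ ⊢_) (cong (renT suc a ≐_) (sym (renT-2^ suc r)))
    (≐-trans (≐-sym a≐2^r⊗y) (≐-trans (⊗-congˡ (A-discrete₁ A-y 1≤y y<2)) (⊗-identityʳ (2^ r)))))
  where
  Δ = (renT suc (2^ r) ⊗ v0 ≐ renT suc a) ∷ map wk Γ
  a≐2^r⊗y : Δ ⊢ 2^ r ⊗ v0 ≐ renT suc a
  a≐2^r⊗y = subst (λ x → Δ ⊢ x ⊗ v0 ≐ renT suc a) (renT-2^ suc r) hyp₀
  A-y : Δ ⊢ A v0
  A-y = A-cancelˡ (A-2^ r) (A-resp-≐ (≐-sym a≐2^r⊗y) (⊢-wk Aa))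
  1≤y : Δ ⊢ `1 ≤' v0
  1≤y = ⊗-cancelˡ-≤' (2^-pos r) (≤'-respʳ-≐ (≐-sym a≐2^r⊗y)
    (≤'-respˡ-≐ (≐-sym (⊗-identityʳ (2^ r))) (subst (λ x → Δ ⊢ x ≤' renT suc a) (renT-2^ suc r) (⊢-wk lo))))
  y<2 : Δ ⊢ v0 <' two
  y<2 = ⊗-cancelˡ-<' (2^-pos r) (<'-respʳ-≐ (^'-suc two r)
    (<'-respˡ-≐ (≐-sym a≐2^r⊗y) (subst (λ x → Δ ⊢ renT suc a <' x) (renT-2^ suc (suc r)) (⊢-wk hi))))

-- Roots of positive elements

HasRoot : ℕ → Term n → Formula n
HasRoot N a = ∃' (`0 <' v0 ∧' v0 ^' N ≐ renT suc a)

wk-HasRoot : ∀ N (a : Term n) → wk (HasRoot N a) ≡ HasRoot N (renT suc a)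
wk-HasRoot N a = cong₂ (λ x y → ∃' (`0 <' v0 ∧' x ≐ y)) (renT-^' (ext suc) v0 N) (wk-ext suc a)

hasRoot-intro : ∀ {w} N → Γ ⊢ `0 <' w → Γ ⊢ w ^' N ≐ a → Γ ⊢ HasRoot N a
hasRoot-intro {a = a} {w = w} N w>0 e = ∃I w
  (subst₂ (λ x y → _ ⊢ `0 <' w ∧' x ≐ y) (sym (subT-^' (single w) v0 N)) (sym (single-wk w a)) (∧I w>0 e))

allsN-E : ∀ m (φ : Formula m) → Γ ⊢ closeF (allsN m φ) → (σ : Fin m → Term n) → Γ ⊢ subF σ φ
allsN-E zero φ d σ = subst (_ ⊢_) (trans (sym (subF-var∘ (λ ()) φ)) (subF-cong (λ ()) φ)) d
allsN-E (suc m) φ d σ =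
  subst (_ ⊢_) (trans (subF-∘ (single (σ zero)) (exts (σ ∘ suc)) φ) (subF-cong instantiate φ))
    (∀E (allsN-E m (∀' φ) d (σ ∘ suc)) (σ zero))
  where
  instantiate : subT (single (σ zero)) ∘ exts (σ ∘ suc) ≗ σ
  instantiate zero = refl
  instantiate (suc i) = single-wk (σ zero) (σ (suc i))

subT-horner : (σ : Fin n → Term m) (x : Term n) (cs : List (Term n)) →
              subT σ (horner x cs) ≡ horner (subT σ x) (map (subT σ) cs)
subT-horner σ x [] = refl
subT-horner σ x (c ∷ cs) = cong (λ z → z ⊗ subT σ x ⊕ subT σ c) (subT-horner σ x cs)

horner-zeros : ∀ m (x : Term n) → Γ ⊢ horner x (tabulate {n = m} (λ _ → `0)) ≐ x ^' m
horner-zeros zero x = ≐-refl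
horner-zeros (suc m) x =
  ≐-trans (⊕-identityʳ _) (≐-trans (⊗-congʳ (horner-zeros m x)) (≐-sym (^'-suc x m)))

odd-^'-neg : ∀ k → Γ ⊢ a <' `0 → Γ ⊢ a ^' suc (k + k) <' `0
odd-^'-neg {a = a} k a<0 = <'-respˡ-≐ (≐-sym (^'-suc a (k + k)))
  (⊗-negʳ-<' (<'-respʳ-≐ (≐-trans (^'-distrib-⊗ a a k) (^'-+ a k k))
    (^'-pos k (<'-respʳ-≐ (neg⊗neg a a) (⊗-pos (neg-pos a<0) (neg-pos a<0))))) a<0)

odd-^'-pos⁻¹ : ∀ k → Γ ⊢ a ^' suc (k + k) ≐ b → Γ ⊢ `0 <' b → Γ ⊢ `0 <' a
odd-^'-pos⁻¹ k e b>0 = ∨E₃ (<'-cmp `0 _) hyp₀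
  (contradict (<'-respʳ-≐ (≐-trans (≐-sym (weaken₁ e))
      (≐-trans (^'-cong (suc (k + k)) (≐-sym hyp₀)) (0^'suc (k + k)))) (weaken₁ b>0)) (<'-irrefl `0))
  (<'-asym (weaken₁ b>0) (<'-respˡ-≐ (weaken₁ e) (odd-^'-neg k hyp₀)))

-- The odd-degree axiom applied to x^(2k+1) - a, i.e. to the coefficients (-a, 0, …, 0).
hasRoot-odd : ∀ k → Γ ⊢ `0 <' a → Γ ⊢ HasRoot (suc (k + k)) a
hasRoot-odd {Γ = Γ} {a = a} k a>0 =
  ∃E root (subst (Δ ⊢_) (sym (wk-HasRoot N a)) (hasRoot-intro N (odd-^'-pos⁻¹ k x^N≐a (⊢-wk a>0)) x^N≐a))
  where
  N = suc (k + k)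
  coefficients : Fin N → Term _
  coefficients zero = neg a
  coefficients (suc i) = `0
  zeros = tabulate {n = k + k} (λ _ → `0)
  instantiated : subT (exts coefficients) (horner v0 (map (var ∘ suc) (allFin N))) ≡ horner v0 (neg (renT suc a) ∷ zeros)
  instantiated = trans (subT-horner (exts coefficients) v0 (map (var ∘ suc) (allFin N)))
    (cong (horner v0) (trans (cong (map (subT (exts coefficients))) (map-tabulate {n = N} (λ i → i) (var ∘ suc)))
      (map-tabulate {n = N} (var ∘ suc) (subT (exts coefficients)))))
  root : Γ ⊢ ∃' (horner v0 (neg (renT suc a) ∷ zeros) ≐ `0)
  root = subst (λ z → Γ ⊢ ∃' (z ≐ `0)) instantiated (allsN-E N _ (ax (odd-root k)) coefficients)
  Δ = (horner v0 (neg (renT suc a) ∷ zeros) ≐ `0) ∷ map wk Γ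
  x^N≐a : Δ ⊢ v0 ^' N ≐ renT suc a
  x^N≐a = ⊕-cancelʳ _ _ (neg (renT suc a)) (≐-trans
    (⊕-congʳ (≐-trans (^'-suc v0 (k + k)) (⊗-congʳ (≐-sym (horner-zeros (k + k) v0)))))
    (≐-trans hyp₀ (≐-sym (⊕-inverseʳ (renT suc a)))))

hasRoot-from-square : ∀ {z w} K → Γ ⊢ `0 <' z → Γ ⊢ z ⊗ z ≐ w → Γ ⊢ w ^' K ≐ a → Γ ⊢ HasRoot (K + K) a
hasRoot-from-square {z = z} K z>0 z²≐w w^K≐a = hasRoot-intro (K + K) z>0
  (≐-trans (≐-sym (^'-+ z K K)) (≐-trans (≐-sym (^'-distrib-⊗ z z K)) (≐-trans (^'-cong K z²≐w) w^K≐a)))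

-- The root is |z| for a square root z of w; z ≠ 0 as w > 0.
hasRoot-double : ∀ K → Γ ⊢ HasRoot K a → Γ ⊢ HasRoot (K + K) a
hasRoot-double {Γ = Γ} {a = a} K d = ∃E d (subst (Δ₁ ⊢_) (sym (wk-HasRoot (K + K) a)) (∃E √w body))
  where
  Δ₁ = (`0 <' v0 ∧' v0 ^' K ≐ renT suc a) ∷ map wk Γ
  w = renT suc v0
  √w : Δ₁ ⊢ ∃' (v0 ⊗ v0 ≐ w)
  √w = ⇒E (∀E (ax sqrt) v0) (∧E₁ hyp₀)
  Δ₂ = (v0 ⊗ v0 ≐ w) ∷ map wk Δ₁
  w>0 : Δ₂ ⊢ `0 <' w
  w>0 = ⊢-wk (∧E₁ hyp₀)
  w^K≐a : Δ₂ ⊢ w ^' K ≐ renT suc (renT suc a)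
  w^K≐a = subst (λ x → Δ₂ ⊢ x ≐ _) (renT-^' suc v0 K) (⊢-wk (∧E₂ hyp₀))
  body : Δ₂ ⊢ wk (HasRoot (K + K) (renT suc a))
  body = subst (Δ₂ ⊢_) (sym (wk-HasRoot (K + K) (renT suc a))) (∨E₃ (<'-cmp `0 v0)
    (hasRoot-from-square K hyp₀ (weaken₁ hyp₀) (weaken₁ w^K≐a))
    (contradict (<'-respʳ-≐
        (≐-trans (≐-sym (weaken₁ hyp₀)) (≐-trans (⊗-cong (≐-sym hyp₀) (≐-sym hyp₀)) (⊗-zeroʳ `0)))
      (weaken₁ w>0)) (<'-irrefl `0))
    (hasRoot-from-square K (neg-pos hyp₀) (≐-trans (neg⊗neg v0 v0) (weaken₁ hyp₀)) (weaken₁ w^K≐a)))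

even-or-odd : ∀ m → (Σ ℕ λ k → m ≡ k + k) ⊎ (Σ ℕ λ k → m ≡ suc (k + k))
even-or-odd zero = inj₁ (0 , refl)
even-or-odd (suc m) with even-or-odd m
... | inj₁ (k , m≡2k) = inj₂ (k , cong suc m≡2k)
... | inj₂ (k , m≡2k+1) = inj₁ (suc k , cong suc (trans m≡2k+1 (sym (ℕ.+-suc k k))))

hasRoot : ∀ N → Γ ⊢ `0 <' a → Γ ⊢ HasRoot (suc N) a
hasRoot N = <-rec (λ N → ∀ {n} {Γ : List (Formula n)} {a} → Γ ⊢ `0 <' a → Γ ⊢ HasRoot (suc N) a) step N
  where
  step : ∀ N → (∀ {j} → j ℕ.< N → ∀ {n} {Γ : List (Formula n)} {a} → Γ ⊢ `0 <' a → Γ ⊢ HasRoot (suc j) a) →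
         ∀ {n} {Γ : List (Formula n)} {a} → Γ ⊢ `0 <' a → Γ ⊢ HasRoot (suc N) a
  step N rec {Γ = Γ} {a} a>0 with even-or-odd (suc N)
  ... | inj₂ (k , N+1≡2k+1) = subst (λ m → Γ ⊢ HasRoot m a) (sym N+1≡2k+1) (hasRoot-odd k a>0)
  ... | inj₁ (suc j , N+1≡2j+2) = subst (λ m → Γ ⊢ HasRoot m a) (sym N+1≡2j+2)
    (hasRoot-double (suc j) (rec j<N a>0))
    where
    j<N : j ℕ.< N
    j<N = subst (j ℕ.<_) (sym (ℕ.suc-injective N+1≡2j+2)) (ℕ.m<m+n j (ℕ.s≤s ℕ.z≤n))

-- Cosets of A^M in A

Coset : ℕ → ℕ → Term n → Formula n
Coset M r a = ∃' (A v0 ∧' renT suc a ≐ 2^ r ⊗ v0 ^' M)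

InSomeCoset : ℕ → ℕ → Term n → Formula n
InSomeCoset M zero a = ⊥'
InSomeCoset M (suc k) a = InSomeCoset M k a ∨' Coset M k a

wk-Coset : ∀ M r (a : Term n) → wk (Coset M r a) ≡ Coset M r (renT suc a)
wk-Coset M r a = cong₂ (λ x y → ∃' (A v0 ∧' x ≐ y)) (wk-ext suc a)
  (cong₂ _⊗_ (renT-2^ (ext suc) r) (renT-^' (ext suc) v0 M))

wk-InSomeCoset : ∀ M k (a : Term n) → wk (InSomeCoset M k a) ≡ InSomeCoset M k (renT suc a)
wk-InSomeCoset M zero a = refl
wk-InSomeCoset M (suc k) a = cong₂ _∨'_ (wk-InSomeCoset M k a) (wk-Coset M k a)

coset-intro : ∀ M r → Γ ⊢ A b → Γ ⊢ a ≐ 2^ r ⊗ b ^' M → Γ ⊢ Coset M r a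
coset-intro {Γ = Γ} {b = b} {a = a} M r Ab e = ∃I b (subst₂ (λ x y → Γ ⊢ A b ∧' x ≐ y) (sym (single-wk b a))
  (sym (cong₂ _⊗_ (subT-2^ (single b) r) (subT-^' (single b) v0 M))) (∧I Ab e))

inSomeCoset-intro : ∀ M {r} k → r ℕ.< k → Γ ⊢ Coset M r a → Γ ⊢ InSomeCoset M k a
inSomeCoset-intro M (suc k) r<1+k d with ℕ.m<1+n⇒m<n∨m≡n r<1+k
... | inj₁ r<k = ∨I₁ (inSomeCoset-intro M k r<k d)
... | inj₂ refl = ∨I₂ d

inSomeCoset-elim : ∀ M k → Γ ⊢ InSomeCoset M k a → (∀ r → r ℕ.< k → (Coset M r a ∷ Γ) ⊢ ψ) → Γ ⊢ ψ
inSomeCoset-elim M zero d cases = ⊥E d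
inSomeCoset-elim M (suc k) d cases = ∨E d
  (inSomeCoset-elim M k hyp₀ (λ r r<k → weaken-under (cases r (ℕ.m≤n⇒m≤1+n r<k))))
  (cases k ℕ.≤-refl)

A-dyadic-cases : ∀ m → Γ ⊢ A a → Γ ⊢ `1 ≤' a → Γ ⊢ a <' 2^ suc m →
                 (∀ r → r ℕ.< suc m → ((a ≐ 2^ r) ∷ Γ) ⊢ ψ) → Γ ⊢ ψ
A-dyadic-cases zero Aa 1≤a a<2 cases = cut (A-discrete 0 Aa 1≤a a<2) (cases 0 (ℕ.s≤s ℕ.z≤n))
A-dyadic-cases {a = a} (suc m) Aa 1≤a a<2^m+2 cases = by-cases {φ = a <' 2^ suc m}
  (A-dyadic-cases m (weaken₁ Aa) (weaken₁ 1≤a) hyp₀ (λ r r<m+1 → weaken-under (cases r (ℕ.m≤n⇒m≤1+n r<m+1))))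
  (cut (A-discrete (suc m) (weaken₁ Aa) (≮'⇒≥' hyp₀) (weaken₁ a<2^m+2)) (weaken-under (cases (suc m) ℕ.≤-refl)))

A-bracket⇒inSomeCoset : ∀ M' → let M = suc M' in Γ ⊢ A b → Γ ⊢ A a →
  Γ ⊢ b ^' M ≤' a → Γ ⊢ a <' 2^ M ⊗ b ^' M → Γ ⊢ InSomeCoset M M a
A-bracket⇒inSomeCoset {Γ = Γ} {b = b} {a = a} M' Ab Aa lo hi = ∃E (quotient a (^'-pos M (A⇒pos Ab)))
  (subst (Δ ⊢_) (sym (wk-InSomeCoset M M a))
    (A-dyadic-cases M' A-q 1≤q q<2^M (λ r r<M → inSomeCoset-intro M M r<M (coset-intro M r (weaken₁ (⊢-wk Ab))
      (≐-trans (≐-sym (weaken₁ a≐b^M⊗q)) (≐-trans (⊗-congˡ hyp₀) (⊗-comm (b' ^' M) (2^ r))))))))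
  where
  M = suc M'
  b' = renT suc b
  a' = renT suc a
  Δ = (renT suc (b ^' M) ⊗ v0 ≐ a') ∷ map wk Γ
  a≐b^M⊗q : Δ ⊢ b' ^' M ⊗ v0 ≐ a'
  a≐b^M⊗q = subst (λ x → Δ ⊢ x ⊗ v0 ≐ a') (renT-^' suc b M) hyp₀
  b^M>0 : Δ ⊢ `0 <' b' ^' M
  b^M>0 = ^'-pos M (A⇒pos (⊢-wk Ab))
  A-q : Δ ⊢ A v0
  A-q = A-cancelˡ (A-^' M (⊢-wk Ab)) (A-resp-≐ (≐-sym a≐b^M⊗q) (⊢-wk Aa))
  1≤q : Δ ⊢ `1 ≤' v0
  1≤q = ⊗-cancelˡ-≤' b^M>0 (≤'-respʳ-≐ (≐-sym a≐b^M⊗q) (≤'-respˡ-≐ (≐-sym (⊗-identityʳ (b' ^' M)))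
    (subst (λ x → Δ ⊢ x ≤' a') (renT-^' suc b M) (⊢-wk lo))))
  q<2^M : Δ ⊢ v0 <' 2^ M
  q<2^M = ⊗-cancelˡ-<' b^M>0 (<'-respˡ-≐ (≐-sym a≐b^M⊗q) (<'-respʳ-≐ (⊗-comm (2^ M) (b' ^' M))
    (subst₂ (λ x y → Δ ⊢ a' <' x ⊗ y) (renT-2^ suc M) (renT-^' suc b M) (⊢-wk hi))))

-- With w an M-th root of a and b = λ(w), b ≤ w < 2b brackets a between b^M and 2^M b^M.
A⇒inSomeCoset : ∀ M' → Γ ⊢ A a → Γ ⊢ InSomeCoset (suc M') (suc M') a
A⇒inSomeCoset {Γ = Γ} {a = a} M' Aa = ∃E (hasRoot M' (A⇒pos Aa))
  (subst (Δ ⊢_) (sym (wk-InSomeCoset M M a)) (A-bracket⇒inSomeCoset M' A-λw (⊢-wk Aa)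
    (≤'-respʳ-≐ (∧E₂ hyp₀) (^'-mono-≤' M (A⇒pos A-λw) (∧E₁ (∧E₂ λw-spec))))
    (<'-respˡ-≐ (∧E₂ hyp₀) (<'-respʳ-≐ (^'-distrib-⊗ two (lam v0) M)
      (^'-mono-<' M' (∧E₁ hyp₀) (∧E₂ (∧E₂ λw-spec)))))))
  where
  M = suc M'
  Δ = (`0 <' v0 ∧' v0 ^' M ≐ renT suc a) ∷ map wk Γ
  λw-spec : Δ ⊢ A (lam v0) ∧' lam v0 ≤' v0 ∧' v0 <' two ⊗ lam v0
  λw-spec = λ-spec (∧E₁ hyp₀)
  A-λw : Δ ⊢ A (lam v0)
  A-λw = ∧E₁ λw-spec

-- Atoms on the cosets

APower : ℕ → Term n → Formula n
APower k t = ∃' (A v0 ∧' v0 ^' k ≐ renT suc t)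

D⇔APower : ∀ k {{_ : NonZero k}} t → Γ ⊢ D k t ⇔ APower k t
D⇔APower {Γ = Γ} k t = subst (Γ ⊢_) (instantiate _) (∀E (ax (D-def k)) t)
  where
  axiom : Formula 1
  axiom = D k v0 ⇔ ∃' (A v0 ∧' (v0 ^' k) ≐ v1)
  single-ext : (ρ : Fin 0 → Fin _) → single t ∘ ext ρ ≗ λ _ → t
  single-ext ρ zero = refl
  single-ext ρ (suc ())
  instantiate : (ρ : Fin 0 → Fin _) → renF (ext ρ) axiom [ t ] ≡ (D k t ⇔ APower k t)
  instantiate ρ = trans (subF-renF (single t) (ext ρ) axiom) (trans (subF-cong (single-ext ρ) axiom)
    (cong (λ x → D k t ⇔ ∃' (A v0 ∧' x ≐ renT suc t)) (subT-^' (exts (λ _ → t)) v0 k)))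

aPower-intro : ∀ {e} k → Γ ⊢ A e → Γ ⊢ e ^' k ≐ t → Γ ⊢ APower k t
aPower-intro {Γ = Γ} {t = t} {e = e} k Ae e^k≐t = ∃I e
  (subst₂ (λ x y → Γ ⊢ A e ∧' x ≐ y) (sym (subT-^' (single e) v0 k)) (sym (single-wk e t)) (∧I Ae e^k≐t))

¬A⇒¬D : ∀ k {{_ : NonZero k}} s → Γ ⊢ ¬' (A a) → Γ ⊢ ¬' (D k (2^ s ⊗ a))
¬A⇒¬D {Γ = Γ} {a = a} k s ¬Aa = ⇒I (∃E (⇔E₁ (D⇔APower k _) hyp₀)
  (⇒E (⊢-wk (weaken₁ ¬Aa)) (A-cancelˡ (A-2^ s) (A-resp-≐ e^k≐2^s⊗a (A-^' k (∧E₁ hyp₀))))))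
  where
  Δ = (A v0 ∧' v0 ^' k ≐ renT suc (2^ s ⊗ a)) ∷ map wk (D k (2^ s ⊗ a) ∷ Γ)
  e^k≐2^s⊗a : Δ ⊢ v0 ^' k ≐ 2^ s ⊗ renT suc a
  e^k≐2^s⊗a = subst (λ x → Δ ⊢ v0 ^' k ≐ x ⊗ renT suc a) (renT-2^ suc s) (∧E₂ hyp₀)

2^⊗^'-^' : ∀ q c k → Γ ⊢ (2^ q ⊗ b ^' c) ^' k ≐ 2^ (q * k) ⊗ b ^' (c * k)
2^⊗^'-^' {b = b} q c k = ≐-trans (^'-distrib-⊗ (2^ q) (b ^' c) k) (⊗-cong (^'-* two q k) (^'-* b c k))

D-true : ∀ k {{_ : NonZero k}} {K M} → k ∣ K → k ∣ M → Γ ⊢ A b → Γ ⊢ D k (2^ K ⊗ b ^' M)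
D-true k (divides q refl) (divides c refl) Ab =
  ⇔E₂ (D⇔APower k _) (aPower-intro k (A-⊗ (A-2^ q) (A-^' c Ab)) (2^⊗^'-^' q c k))

A-<'⇒2⊗≤' : Γ ⊢ A b → Γ ⊢ A c → Γ ⊢ b <' c → Γ ⊢ two ⊗ b ≤' c
A-<'⇒2⊗≤' {Γ = Γ} {b = b} {c = c} Ab Ac b<c = ∃E (quotient c (A⇒pos Ab))
  (≤'-respʳ-≐ hyp₀ (≤'-respˡ-≐ (⊗-comm (renT suc b) two) (⊗-monoʳ-≤' (A⇒pos (⊢-wk Ab)) 2≤q)))
  where
  Δ = (renT suc b ⊗ v0 ≐ renT suc c) ∷ map wk Γ
  A-q : Δ ⊢ A v0
  A-q = A-cancelˡ (⊢-wk Ab) (A-resp-≐ (≐-sym hyp₀) (⊢-wk Ac))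
  1<q : Δ ⊢ `1 <' v0
  1<q = ⊗-cancelˡ-<' (A⇒pos (⊢-wk Ab))
    (<'-respˡ-≐ (≐-sym (⊗-identityʳ (renT suc b))) (<'-respʳ-≐ (≐-sym hyp₀) (⊢-wk b<c)))
  2≤q : Δ ⊢ two ≤' v0
  2≤q = ≮'⇒≥' (⇒I (A-gap (weaken₁ 1<q) hyp₀ (weaken₁ A-q)))

-- Compare c with b: if c ≤ b the left side is too small, and if c > b then c ≥ 2b makes it
-- at least 2^N b^N, too large.
2^∉A^ : ∀ N' j → j ℕ.< N' → let N = suc N' in
        Γ ⊢ A c → Γ ⊢ A b → Γ ⊢ c ^' N ≐ 2^ suc j ⊗ b ^' N → Γ ⊢ ⊥'
2^∉A^ {c = c} {b = b} N' j j<N' Ac Ab c^N≐2^j⊗b^N = by-cases {φ = b <' c}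
  (contradict (<'-respʳ-≐ (weaken₁ c^N≐2^j⊗b^N) (<'-≤'-trans
      (⊗-monoˡ-<' (weaken₁ b^N>0) (2^-mono-<' N (ℕ.s≤s j<N')))
      (≤'-respˡ-≐ (^'-distrib-⊗ two b N)
        (^'-mono-≤' N (weaken₁ (⊗-pos 0<'2 b>0)) (A-<'⇒2⊗≤' (weaken₁ Ab) (weaken₁ Ac) hyp₀)))))
    (<'-irrefl _))
  (contradict (<'-respˡ-≐ (weaken₁ c^N≐2^j⊗b^N) (≤'-<'-trans
      (^'-mono-≤' N (weaken₁ (A⇒pos Ac)) (≮'⇒≥' hyp₀))
      (<'-respˡ-≐ (⊗-identityˡ (b ^' N)) (⊗-monoˡ-<' (weaken₁ b^N>0) (1<'2^suc j)))))
    (<'-irrefl _))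
  where
  N = suc N'
  b>0 = A⇒pos Ab
  b^N>0 = ^'-pos N b>0

¬D-2^⊗^' : ∀ N' j → j ℕ.< N' → Γ ⊢ A b → Γ ⊢ ¬' (D (suc N') (2^ suc j ⊗ b ^' suc N'))
¬D-2^⊗^' {Γ = Γ} {b = b} N' j j<N' Ab = ⇒I (∃E (⇔E₁ (D⇔APower N _) hyp₀)
  (2^∉A^ N' j j<N' (∧E₁ hyp₀) (⊢-wk (weaken₁ Ab)) e^N≐2^j⊗b^N))
  where
  N = suc N'
  Δ = (A v0 ∧' v0 ^' N ≐ renT suc (2^ suc j ⊗ b ^' N)) ∷ map wk (D N (2^ suc j ⊗ b ^' N) ∷ Γ)
  e^N≐2^j⊗b^N : Δ ⊢ v0 ^' N ≐ 2^ suc j ⊗ renT suc b ^' N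
  e^N≐2^j⊗b^N = subst₂ (λ x y → Δ ⊢ v0 ^' N ≐ x ⊗ y) (renT-2^ suc (suc j)) (renT-^' suc b N) (∧E₂ hyp₀)

D-false : ∀ k {{_ : NonZero k}} {K M} → ¬ (k ∣ K) → k ∣ M → Γ ⊢ A b → Γ ⊢ ¬' (D k (2^ K ⊗ b ^' M))
D-false {Γ = Γ} {b = b} (suc N') {K} k∤K (divides c refl) Ab with K % suc N' in K%N≡
... | zero = contradiction (m%n≡0⇒n∣m K (suc N') K%N≡) k∤K
... | suc j =
  ⇒I (⇒E (weaken₁ (¬D-2^⊗^' N' j j<N' (A-⊗ (A-2^ q) (A-^' c Ab)))) (D-resp-≐ N (weaken₁ split) hyp₀))
  where
  N = suc N'
  q = K / N
  j<N' : j ℕ.< N'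
  j<N' = ℕ.≤-pred (subst (ℕ._< N) K%N≡ (m%n<n K N))
  K≡j+1+qN : K ≡ suc j + q * N
  K≡j+1+qN = trans (m≡m%n+[m/n]*n K N) (cong (_+ q * N) K%N≡)
  split : Γ ⊢ 2^ K ⊗ b ^' (c * N) ≐ 2^ suc j ⊗ (2^ q ⊗ b ^' c) ^' N
  split = subst (λ x → Γ ⊢ 2^ x ⊗ b ^' (c * N) ≐ 2^ suc j ⊗ (2^ q ⊗ b ^' c) ^' N) (sym K≡j+1+qN)
    (2^ (suc j + q * N) ⊗ b ^' (c * N)          ≐⟨ ⊗-congʳ (≐-sym (^'-+ two (suc j) (q * N))) ⟩
     (2^ suc j ⊗ 2^ (q * N)) ⊗ b ^' (c * N)     ≐⟨ ⊗-assoc _ _ _ ⟩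
     2^ suc j ⊗ (2^ (q * N) ⊗ b ^' (c * N))     ≐⟨ ⊗-congˡ (≐-sym (2^⊗^'-^' q c N)) ⟩
     2^ suc j ⊗ (2^ q ⊗ b ^' c) ^' N            ∎)

renF-⟦⟧ : (ρ : Fin n → Fin m) (θ : BComb) (t : Term n) → renF ρ (⟦ θ ⟧ t) ≡ ⟦ θ ⟧ (renT ρ t)
renF-⟦⟧ ρ (atom n {{nz}} s) t = cong (λ x → D n {{nz}} (x ⊗ renT ρ t)) (renT-2^ ρ s)
renF-⟦⟧ ρ (notB θ) t = cong ¬' (renF-⟦⟧ ρ θ t)
renF-⟦⟧ ρ (andB θ ψ) t = cong₂ _∧'_ (renF-⟦⟧ ρ θ t) (renF-⟦⟧ ρ ψ t)
renF-⟦⟧ ρ (orB θ ψ) t = cong₂ _∨'_ (renF-⟦⟧ ρ θ t) (renF-⟦⟧ ρ ψ t)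

subF-⟦⟧ : (σ : Fin n → Term m) (θ : BComb) (t : Term n) → subF σ (⟦ θ ⟧ t) ≡ ⟦ θ ⟧ (subT σ t)
subF-⟦⟧ σ (atom n {{nz}} s) t = cong (λ x → D n {{nz}} (x ⊗ subT σ t)) (subT-2^ σ s)
subF-⟦⟧ σ (notB θ) t = cong ¬' (subF-⟦⟧ σ θ t)
subF-⟦⟧ σ (andB θ ψ) t = cong₂ _∧'_ (subF-⟦⟧ σ θ t) (subF-⟦⟧ σ ψ t)
subF-⟦⟧ σ (orB θ ψ) t = cong₂ _∨'_ (subF-⟦⟧ σ θ t) (subF-⟦⟧ σ ψ t)

-- The truth value of each atom D_n(2^s x), as a function of (n, s), when x ∉ A (offA)
-- and when x ∈ 2^t A^M (onCoset t).
evalB : (ℕ → ℕ → Bool) → BComb → Bool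
evalB f (atom n s) = f n s
evalB f (notB θ) = not (evalB f θ)
evalB f (andB θ ψ) = evalB f θ ∧ evalB f ψ
evalB f (orB θ ψ) = evalB f θ ∨ evalB f ψ

offA : ℕ → ℕ → Bool
offA n s = false

onCoset : ℕ → ℕ → ℕ → Bool
onCoset t n s = does (n ∣? (s + t))

evalB-cong : ∀ {M} {f g : ℕ → ℕ → Bool} θ → All (_∣ M) (indices θ) →
             (∀ n s → n ∣ M → f n s ≡ g n s) → evalB f θ ≡ evalB g θ
evalB-cong (atom n s) (n∣M ∷ []) f≡g = f≡g n s n∣M
evalB-cong (notB θ) ∣M f≡g = cong not (evalB-cong θ ∣M f≡g)
evalB-cong (andB θ ψ) ∣M f≡g =
  cong₂ _∧_ (evalB-cong θ (++⁻ˡ (indices θ) ∣M) f≡g) (evalB-cong ψ (++⁻ʳ (indices θ) ∣M) f≡g)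
evalB-cong (orB θ ψ) ∣M f≡g =
  cong₂ _∨_ (evalB-cong θ (++⁻ˡ (indices θ) ∣M) f≡g) (evalB-cong ψ (++⁻ʳ (indices θ) ∣M) f≡g)

onCoset-periodic : ∀ {M} t n s → n ∣ M → onCoset (M + t) n s ≡ onCoset t n s
onCoset-periodic {M} t n s n∣M = does-⇔ (mk⇔
  (λ n∣s+M+t → ∣m+n∣m⇒∣n (subst (n ∣_) reassoc n∣s+M+t) n∣M)
  (λ n∣s+t → subst (n ∣_) (sym reassoc) (∣m∣n⇒∣m+n n∣M n∣s+t))) (n ∣? (s + (M + t))) (n ∣? (s + t))
  where
  reassoc : s + (M + t) ≡ M + (s + t)
  reassoc = trans (sym (ℕ.+-assoc s M t)) (trans (cong (_+ t) (ℕ.+-comm s M)) (ℕ.+-assoc M s t))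

Decides : List (Formula n) → Bool → Formula n → Set
Decides Γ true φ = Γ ⊢ φ
Decides Γ false φ = Γ ⊢ ¬' φ

decides-¬' : ∀ v → Decides Γ v φ → Decides Γ (not v) (¬' φ)
decides-¬' true d = ⇒I (⇒E hyp₀ (weaken₁ d))
decides-¬' false d = d

decides-∧' : ∀ v w → Decides Γ v φ → Decides Γ w ψ → Decides Γ (v ∧ w) (φ ∧' ψ)
decides-∧' true true d e = ∧I d e
decides-∧' true false d e = ⇒I (⇒E (weaken₁ e) (∧E₂ hyp₀))
decides-∧' false w d e = ⇒I (⇒E (weaken₁ d) (∧E₁ hyp₀))

decides-∨' : ∀ v w → Decides Γ v φ → Decides Γ w ψ → Decides Γ (v ∨ w) (φ ∨' ψ)
decides-∨' true w d e = ∨I₁ d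
decides-∨' false true d e = ∨I₂ e
decides-∨' false false d e = ⇒I (∨E hyp₀ (⇒E (weaken₁ (weaken₁ d)) hyp₀) (⇒E (weaken₁ (weaken₁ e)) hyp₀))

⟦⟧-decides : ∀ {M} (f : ℕ → ℕ → Bool) θ → All (_∣ M) (indices θ) →
  (∀ k {{_ : NonZero k}} s → k ∣ M → Decides Γ (f k s) (D k (2^ s ⊗ a))) → Decides Γ (evalB f θ) (⟦ θ ⟧ a)
⟦⟧-decides f (atom k {{nz}} s) (k∣M ∷ []) atoms = atoms k {{nz}} s k∣M
⟦⟧-decides f (notB θ) ∣M atoms = decides-¬' (evalB f θ) (⟦⟧-decides f θ ∣M atoms)
⟦⟧-decides f (andB θ ψ) ∣M atoms = decides-∧' (evalB f θ) (evalB f ψ)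
  (⟦⟧-decides f θ (++⁻ˡ (indices θ) ∣M) atoms) (⟦⟧-decides f ψ (++⁻ʳ (indices θ) ∣M) atoms)
⟦⟧-decides f (orB θ ψ) ∣M atoms = decides-∨' (evalB f θ) (evalB f ψ)
  (⟦⟧-decides f θ (++⁻ˡ (indices θ) ∣M) atoms) (⟦⟧-decides f ψ (++⁻ʳ (indices θ) ∣M) atoms)

offA-decides : ∀ {M} → Γ ⊢ ¬' (A a) → ∀ k {{_ : NonZero k}} s → k ∣ M → Decides Γ (offA k s) (D k (2^ s ⊗ a))
offA-decides ¬Aa k s _ = ¬A⇒¬D k s ¬Aa

2^⊗-coset : ∀ s t M → Γ ⊢ a ≐ 2^ t ⊗ b ^' M → Γ ⊢ 2^ s ⊗ a ≐ 2^ (s + t) ⊗ b ^' M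
2^⊗-coset s t M e = ≐-trans (⊗-congˡ e) (≐-trans (≐-sym (⊗-assoc _ _ _)) (⊗-congʳ (^'-+ two s t)))

onCoset-decides : ∀ {M} t → Γ ⊢ A b → Γ ⊢ a ≐ 2^ t ⊗ b ^' M →
  ∀ k {{_ : NonZero k}} s → k ∣ M → Decides Γ (onCoset t k s) (D k (2^ s ⊗ a))
onCoset-decides {M = M} t Ab e k s k∣M with k ∣? (s + t)
... | yes k∣s+t = D-resp-≐ k (≐-sym (2^⊗-coset s t M e)) (D-true k k∣s+t k∣M Ab)
... | no k∤s+t = ⇒I (⇒E (weaken₁ (D-false k k∤s+t k∣M Ab)) (D-resp-≐ k (weaken₁ (2^⊗-coset s t M e)) hyp₀))

Witness : ℕ → BComb → Term n → Formula n
Witness M θ u = ∃' ((renT suc u ≤' v0 ∧' v0 <' 2^ M ⊗ renT suc u) ∧' ⟦ θ ⟧ v0)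

witness-intro : ∀ M θ → Γ ⊢ u ≤' a → Γ ⊢ a <' 2^ M ⊗ u → Γ ⊢ ⟦ θ ⟧ a → Γ ⊢ Witness M θ u
witness-intro {Γ = Γ} {u = u} {a = a} M θ u≤a a<2^M⊗u θa =
  ∃I a (subst (Γ ⊢_) (sym instantiate) (∧I (∧I u≤a a<2^M⊗u) θa))
  where
  instantiate : subF (single a) ((renT suc u ≤' v0 ∧' v0 <' 2^ M ⊗ renT suc u) ∧' ⟦ θ ⟧ v0) ≡
                ((u ≤' a ∧' a <' 2^ M ⊗ u) ∧' ⟦ θ ⟧ a)
  instantiate = trans
    (cong₂ (λ x z → (x ≤' a ∧' a <' subT (single a) (2^ M) ⊗ x) ∧' z) (single-wk a u) (subF-⟦⟧ (single a) θ v0))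
    (cong (λ y → (u ≤' a ∧' a <' y ⊗ u) ∧' ⟦ θ ⟧ a) (subT-2^ (single a) M))

wk-Witness : ∀ M θ (u : Term n) → wk (Witness M θ u) ≡ Witness M θ (renT suc u)
wk-Witness M θ u = trans
  (cong₂ (λ x z → ∃' ((x ≤' v0 ∧' v0 <' renT (ext suc) (2^ M) ⊗ x) ∧' z)) (wk-ext suc u) (renF-⟦⟧ (ext suc) θ v0))
  (cong (λ y → ∃' ((renT suc (renT suc u) ≤' v0 ∧' v0 <' y ⊗ renT suc (renT suc u)) ∧' ⟦ θ ⟧ v0)) (renT-2^ (ext suc) M))

offset : ∀ {M r₀ r} → r₀ ℕ.< M → r ℕ.< M → Σ ℕ λ j → j ℕ.< M × (j + r₀ ≡ r ⊎ j + r₀ ≡ M + r)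
offset {M} {r₀} {r} r₀<M r<M with r₀ ℕ.≤? r
... | yes r₀≤r = r ∸ r₀ , ℕ.≤-<-trans (ℕ.m∸n≤m r r₀) r<M , inj₁ (ℕ.m∸n+n≡m r₀≤r)
... | no r₀≰r =
  M + r ∸ r₀ , ℕ.+-cancelʳ-< r₀ _ M (subst (ℕ._< M + r₀) (sym wrap) (ℕ.+-monoʳ-< M (ℕ.≰⇒> r₀≰r))) , inj₂ wrap
  where
  wrap : M + r ∸ r₀ + r₀ ≡ M + r
  wrap = ℕ.m∸n+n≡m (ℕ.≤-trans (ℕ.<⇒≤ r₀<M) (ℕ.m≤m+n M r))

offset⁺ : ∀ {M r₀ r} → r₀ ℕ.< M → r ℕ.< M → Σ ℕ λ j → 0 ℕ.< j × j ℕ.≤ M × (j + r₀ ≡ r ⊎ j + r₀ ≡ M + r)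
offset⁺ {M} {r₀} {r} r₀<M r<M with offset r₀<M r<M
... | suc j , j<M , e = suc j , ℕ.s≤s ℕ.z≤n , ℕ.<⇒≤ j<M , e
... | zero , _ , inj₁ r₀≡r = M , ℕ.<-≤-trans (ℕ.s≤s ℕ.z≤n) r₀<M , ℕ.≤-refl , inj₂ (cong (M +_) r₀≡r)
... | zero , _ , inj₂ r₀≡M+r = contradiction (subst (ℕ._< M) r₀≡M+r r₀<M) (ℕ.m+n≮m M r)

module AtCommonMultiple (θ : BComb) (M' : ℕ) (∣M : All (_∣ suc M') (indices θ)) where

  M : ℕ
  M = suc M'

  θ-offA : evalB offA θ ≡ true → Γ ⊢ ¬' (A a) → Γ ⊢ ⟦ θ ⟧ a
  θ-offA {Γ = Γ} {a = a} θ-true ¬Aa =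
    subst (λ v → Decides Γ v (⟦ θ ⟧ a)) θ-true (⟦⟧-decides offA θ ∣M (offA-decides ¬Aa))

  θ-onCoset : ∀ r t → evalB (onCoset r) θ ≡ true → (t ≡ r ⊎ t ≡ M + r) →
              Γ ⊢ A b → Γ ⊢ a ≐ 2^ t ⊗ b ^' M → Γ ⊢ ⟦ θ ⟧ a
  θ-onCoset {Γ = Γ} {a = a} r t θ-true t≡r Ab a∈coset =
    subst (λ v → Decides Γ v (⟦ θ ⟧ a)) (trans (same-residue t≡r) θ-true)
      (⟦⟧-decides (onCoset t) θ ∣M (onCoset-decides t Ab a∈coset))
    where
    same-residue : (t ≡ r ⊎ t ≡ M + r) → evalB (onCoset t) θ ≡ evalB (onCoset r) θ
    same-residue (inj₁ refl) = refl
    same-residue (inj₂ refl) = evalB-cong θ ∣M (λ k s k∣M → onCoset-periodic r k s k∣M)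

  -- If u ∈ A then x = 3u/2 ∉ A, otherwise x = u.
  witness-offA : evalB offA θ ≡ true → Γ ⊢ `0 <' u → Γ ⊢ Witness M θ u
  witness-offA {Γ = Γ} {u = u} θ-true u>0 = by-cases {φ = A u}
    (∃E (quotient `1 0<'2) (subst (Δ ⊢_) (sym (wk-Witness M θ u))
      (witness-intro M θ (∨I₁ (<'-respˡ-≐ (⊗-identityʳ u') (⊗-monoʳ-<' u'>0 1<x/u)))
        (<'-≤'-trans (<'-respʳ-≐ (⊗-comm u' two) (⊗-monoʳ-<' u'>0 x/u<2))
          (⊗-monoˡ-≤' u'>0 (2^-mono-≤' M (ℕ.s≤s ℕ.z≤n))))
        (θ-offA θ-true (⇒I (A-gap (weaken₁ 1<x/u) (weaken₁ x/u<2) (A-cancelˡ (weaken₁ (⊢-wk hyp₀)) hyp₀)))))))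
    (witness-intro M θ ≤'-refl (<'-respˡ-≐ (⊗-identityˡ u) (⊗-monoˡ-<' (weaken₁ u>0) (1<'2^suc M')))
      (θ-offA θ-true hyp₀))
    where
    Δ = (two ⊗ v0 ≐ `1) ∷ map wk (A u ∷ Γ)
    u' = renT suc u
    u'>0 : Δ ⊢ `0 <' u'
    u'>0 = ⊢-wk (weaken₁ u>0)
    h>0 : Δ ⊢ `0 <' v0
    h>0 = ⊗-cancelˡ-<' 0<'2 (<'-respˡ-≐ (≐-sym (⊗-zeroʳ two)) (<'-respʳ-≐ (≐-sym hyp₀) 0<'1))
    h⊕h≐1 : Δ ⊢ v0 ⊕ v0 ≐ `1
    h⊕h≐1 = ≐-trans (≐-sym (⊕-cong (⊗-identityˡ v0) (⊗-identityˡ v0))) (≐-trans (≐-sym (⊗-distribʳ-⊕ v0 `1 `1)) hyp₀)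
    1<x/u : Δ ⊢ `1 <' `1 ⊕ v0
    1<x/u = <'-respˡ-≐ (⊕-identityˡ `1) (<'-respʳ-≐ (⊕-comm v0 `1) (⊕-monoˡ-<' `1 h>0))
    x/u<2 : Δ ⊢ `1 ⊕ v0 <' two
    x/u<2 = <'-respˡ-≐ (⊕-comm v0 `1)
      (⊕-monoˡ-<' `1 (<'-respˡ-≐ (⊕-identityˡ v0) (<'-respʳ-≐ h⊕h≐1 (⊕-monoˡ-<' v0 h>0))))

  -- λ(u) ≤ u < 2λ(u) and λ(u) ∈ 2^r₀ A^M; the witness is 2^j λ(u) with j + r₀ ≡ r (mod M).
  witness-onCoset : ∀ r → r ℕ.< M → evalB (onCoset r) θ ≡ true → Γ ⊢ `0 <' u → Γ ⊢ Witness M θ u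
  witness-onCoset {Γ = Γ} {u = u} r r<M θ-true u>0 =
    inSomeCoset-elim M M (A⇒inSomeCoset M' (∧E₁ (λ-spec u>0))) near-λu
    where
    near-λu : ∀ r₀ → r₀ ℕ.< M → (Coset M r₀ (lam u) ∷ Γ) ⊢ Witness M θ u
    near-λu r₀ r₀<M = ∃E hyp₀ (subst (Δ ⊢_) (sym (wk-Witness M θ u)) (∨E (∧E₁ (∧E₂ λu-spec)) below equal))
      where
      Δ = (A v0 ∧' renT suc (lam u) ≐ 2^ r₀ ⊗ v0 ^' M) ∷ map wk (Coset M r₀ (lam u) ∷ Γ)
      u' = renT suc u
      ℓ = renT suc (lam u)
      λu-spec : Δ ⊢ A ℓ ∧' ℓ ≤' u' ∧' u' <' two ⊗ ℓ
      λu-spec = ⊢-wk (weaken₁ (λ-spec u>0))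
      ℓ>0 : Δ ⊢ `0 <' ℓ
      ℓ>0 = A⇒pos (∧E₁ λu-spec)
      u'>0 : Δ ⊢ `0 <' u'
      u'>0 = ⊢-wk (weaken₁ u>0)
      θ-2^j⊗ℓ : ∀ j → (j + r₀ ≡ r ⊎ j + r₀ ≡ M + r) → Δ ⊢ ⟦ θ ⟧ (2^ j ⊗ ℓ)
      θ-2^j⊗ℓ j j+r₀≡r = θ-onCoset r (j + r₀) θ-true j+r₀≡r (∧E₁ hyp₀) (2^⊗-coset j r₀ M (∧E₂ hyp₀))
      below : ((ℓ <' u') ∷ Δ) ⊢ Witness M θ u'
      below with offset⁺ r₀<M r<M
      ... | j , 0<j , j≤M , j+r₀≡r = witness-intro M θ
        (∨I₁ (<'-≤'-trans (∧E₂ (∧E₂ (weaken₁ λu-spec))) (⊗-monoˡ-≤' (weaken₁ ℓ>0) (2^-mono-≤' j 0<j))))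
        (<'-≤'-trans (⊗-monoʳ-<' (2^-pos j) hyp₀) (⊗-monoˡ-≤' (weaken₁ u'>0) (2^-mono-≤' M j≤M)))
        (weaken₁ (θ-2^j⊗ℓ j j+r₀≡r))
      equal : ((ℓ ≐ u') ∷ Δ) ⊢ Witness M θ u'
      equal with offset r₀<M r<M
      ... | j , j<M , j+r₀≡r = witness-intro M θ
        (≤'-respˡ-≐ hyp₀ (≤'-respˡ-≐ (⊗-identityˡ ℓ) (⊗-monoˡ-≤' (weaken₁ ℓ>0) (1≤'2^ j))))
        (<'-respʳ-≐ (⊗-congˡ hyp₀) (⊗-monoˡ-<' (weaken₁ ℓ>0) (2^-mono-<' M j<M)))
        (weaken₁ (θ-2^j⊗ℓ j j+r₀≡r))

  refutation : evalB offA θ ≡ false → (∀ r → r ℕ.< M → evalB (onCoset r) θ ≡ false) → Γ ⊢ ¬' (⟦ θ ⟧ a)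
  refutation {Γ = Γ} {a = a} offA-false onCoset-false = by-cases {φ = A a}
    (inSomeCoset-elim M M (A⇒inSomeCoset M' hyp₀) on-coset)
    (subst (λ v → Decides (¬' (A a) ∷ Γ) v (⟦ θ ⟧ a)) offA-false (⟦⟧-decides offA θ ∣M (offA-decides hyp₀)))
    where
    on-coset : ∀ r₀ → r₀ ℕ.< M → (Coset M r₀ a ∷ A a ∷ Γ) ⊢ ¬' (⟦ θ ⟧ a)
    on-coset r₀ r₀<M = ∃E hyp₀ (subst (λ φ → Δ ⊢ φ ⇒ ⊥') (sym (renF-⟦⟧ suc θ a))
      (subst (λ v → Decides Δ v (⟦ θ ⟧ (renT suc a))) (onCoset-false r₀ r₀<M)
        (⟦⟧-decides (onCoset r₀) θ ∣M (onCoset-decides r₀ (∧E₁ hyp₀) (∧E₂ hyp₀)))))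
      where
      Δ = (A v0 ∧' renT suc a ≐ 2^ r₀ ⊗ v0 ^' M) ∷ map wk (Coset M r₀ a ∷ A a ∷ Γ)

  dichotomy : Provable (∀' (¬' (⟦ θ ⟧ v0))) ⊎ Provable (∀' (`0 <' v0 ⇒ Witness M θ v0))
  dichotomy with evalB offA θ in offA-value | ℕ.anyUpTo? (λ r → evalB (onCoset r) θ Bool.≟ true) M
  ... | true | _ = inj₂ (∀I (⇒I (witness-offA offA-value hyp₀)))
  ... | false | yes (r , r<M , θ-true) = inj₂ (∀I (⇒I (witness-onCoset r r<M θ-true hyp₀)))
  ... | false | no no-residue =
    inj₁ (∀I (refutation offA-value (λ r r<M → Bool.¬-not (λ θ-true → no-residue (r , r<M , θ-true)))))

dichotomy : (θ : BComb) (M : ℕ) .{{_ : NonZero M}} → All (_∣ M) (indices θ) →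
  Provable (∀' (¬' (⟦ θ ⟧ v0))) ⊎ Provable (∀' (`0 <' v0 ⇒ Witness M θ v0))
dichotomy θ (suc M') ∣M = AtCommonMultiple.dichotomy θ M' ∣M

lcm-nonZero : ∀ m n → {{NonZero m}} → {{NonZero n}} → NonZero (lcm m n)
lcm-nonZero m n = ℕ.m*n≢0⇒n≢0 (gcd m n) {{subst NonZero (sym (gcd*lcm m n)) (ℕ.m*n≢0 m n)}}

foldr-lcm-nonZero : ∀ {ns} → All NonZero ns → NonZero (foldr lcm 1 ns)
foldr-lcm-nonZero [] = _
foldr-lcm-nonZero (nz ∷ nzs) = lcm-nonZero _ _ {{nz}} {{foldr-lcm-nonZero nzs}}

∣foldr-lcm : ∀ ns → All (_∣ foldr lcm 1 ns) ns
∣foldr-lcm [] = []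
∣foldr-lcm (n ∷ ns) = m∣lcm[m,n] n _ ∷ All.map (λ d → ∣-trans d (n∣lcm[m,n] n _)) (∣foldr-lcm ns)

indices-nonZero : ∀ θ → All NonZero (indices θ)
indices-nonZero (atom n {{nz}} s) = nz ∷ []
indices-nonZero (notB θ) = indices-nonZero θ
indices-nonZero (andB θ ψ) = ++⁺ (indices-nonZero θ) (indices-nonZero ψ)
indices-nonZero (orB θ ψ) = ++⁺ (indices-nonZero θ) (indices-nonZero ψ)

lemma3p17 : (θ : BComb) →
    Provable (∀' (¬' (⟦ θ ⟧ v0)))
    ⊎ Provable (∀' (`0 <' v0 ⇒ ∃' ((v1 ≤' v0 ∧' v0 <' (two ^' lcmIdx θ) ⊗ v1) ∧' ⟦ θ ⟧ v0)))
lemma3p17 θ = dichotomy θ (lcmIdx θ) {{foldr-lcm-nonZero (indices-nonZero θ)}} (∣foldr-lcm (indices θ))
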